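{- Let $(a_l)_{l\geq1}$ and $(b_l)_{l\geq1}$ be sequences of real numbers and let $n\geq k\geq0$, $r\geq0$ be integers. Then $$B^{(r)}_{n+r,k+r}(a_1,a_2,\ldots;b_1,b_2,\ldots)=\binom{n+r}{r}^{ -1}\sum_{j=k}^{n}\binom{n+r}{j}B_{j,k}(a_1,a_2,\ldots)\,B_{n+r-j,r}(1b_1,2b_2,3b_3,\ldots).$$
   Context: The partial Bell polynomials are $B_{n,k}(x_1,x_2,\ldots)=\sum_{\pi(n,k)}\frac{n!}{k_1!\cdots k_n!}\prod_{i=1}^n\left(\frac{x_i}{i!}\right)^{k_i}$, with $\pi(n,k)=\{(k_1,\ldots,k_n)\in\mathbb{N}^n:\sum k_i=k,\ \sum ik_i=n\}$; equivalently $\sum_{n\geq k}B_{n,k}(x_l)\frac{t^n}{n!}=\frac1{k!}\left(\sum_{m\geq1}x_m\frac{t^m}{m!}\right)^k$. For sequences $a,b$ and integers $N,K,r\geq0$, the partial $r$-Bell polynomial is $$B^{(r)}_{N,K}(a_1,a_2,\ldots;b_1,b_2,\ldots)=\sum_{\pi}\ \prod_{B\in\pi,\ B\cap\{1,\ldots,r\}=\emptyset}a_{|B|}\prod_{B\in\pi,\ B\cap\{1,\ldots,r\}\neq\emptyset}b_{|B|},$$ where $\pi$ ranges over the partitions of $\{1,\ldots,N\}$ into exactly $K$ nonempty blocks such that $1,\ldots,r$ lie in pairwise distinct blocks (an empty sum is $0$; the empty partition of the empty set contributes $1$).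
   Formalization: The sequences $(a_l)_{l\geq1}$ and $(b_l)_{l\geq1}$ have rational terms instead of real ones. -}

module Defs where

open import Data.Nat as ℕ using (ℕ; zero; suc; _∸_; _≡ᵇ_; _≤ᵇ_; _!)
open import Data.Nat.Combinatorics using (_C_)
open import Data.Integer using (+_)
open import Data.Rational using (ℚ; 0ℚ; 1ℚ; _/_; _+_; _*_)
open import Data.Bool using (Bool; true; false; if_then_else_; _∧_)
open import Data.List using (List; []; _∷_; map; concatMap; foldr; length; upTo)

ℕtoℚ : ℕ → ℚ
ℕtoℚ m = + m / 1

-- 1/m as a rational (only ever used with m ≠ 0; the value at 0 is an irrelevant convention)
invℕ : ℕ → ℚ
invℕ zero = 0ℚ
invℕ (suc m) = + 1 / suc m

sumℚ : List ℚ → ℚ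
sumℚ = foldr _+_ 0ℚ

prodℚ : List ℚ → ℚ
prodℚ = foldr _*_ 1ℚ

powℚ : ℚ → ℕ → ℚ
powℚ x zero = 1ℚ
powℚ x (suc m) = x * powℚ x m

prodℕ : List ℕ → ℕ
prodℕ = foldr ℕ._*_ 1

sumℕ : List ℕ → ℕ
sumℕ = foldr ℕ._+_ 0

-- Partial Bell polynomial B_{n,k}(x_1,x_2,...) via the explicit formula
-- sum over (k_1,...,k_n) ∈ ℕ^n with Σ k_i = k, Σ i k_i = n of
--   n! / (k_1! ⋯ k_n!) ∏ (x_i / i!)^{k_i}.
-- The sequence x is ℕ → ℚ, and x i is x_i (x 0 is never used).

tuples : ℕ → ℕ → List (List ℕ)
tuples zero bound = [] ∷ []
tuples (suc len) bound =
  concatMap (λ t → map (λ v → v ∷ t) (upTo (suc bound))) (tuples len bound)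

wsum : ℕ → List ℕ → ℕ
wsum s [] = 0
wsum s (c ∷ cs) = s ℕ.* c ℕ.+ wsum (suc s) cs

monom : (ℕ → ℚ) → ℕ → List ℕ → ℚ
monom x s [] = 1ℚ
monom x s (c ∷ cs) = powℚ (x s * invℕ (s !)) c * monom x (suc s) cs

bellTerm : (ℕ → ℚ) → ℕ → ℕ → List ℕ → ℚ
bellTerm x n k ks =
  if (sumℕ ks ≡ᵇ k) ∧ (wsum 1 ks ≡ᵇ n)
  then ℕtoℚ (n !) * invℕ (prodℕ (map _! ks)) * monom x 1 ks
  else 0ℚ

Bell : ℕ → ℕ → (ℕ → ℚ) → ℚ
Bell n k x = sumℚ (map (bellTerm x n k) (tuples n k))

-- Set partitions of {0,…,N-1} (element i stands for i+1), as lists of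
-- blocks; each set partition is produced exactly once (element N is
-- either put in a new singleton block or inserted into an existing block).

insertEach : ℕ → List (List ℕ) → List (List (List ℕ))
insertEach m [] = []
insertEach m (b ∷ bs) = ((m ∷ b) ∷ bs) ∷ map (b ∷_) (insertEach m bs)

setPartitions : ℕ → List (List (List ℕ))
setPartitions zero = [] ∷ []
setPartitions (suc N) =
  concatMap (λ p → ((N ∷ []) ∷ p) ∷ insertEach N p) (setPartitions N)

-- number of elements of a block lying in {1,…,r} (i.e. codes 0,…,r-1)
specials : ℕ → List ℕ → ℕ
specials r b = length (Data.List.filterᵇ (λ i → suc i ≤ᵇ r) b)
  where import Data.List

blockWeight : (ℕ → ℚ) → (ℕ → ℚ) → ℕ → List ℕ → ℚ
blockWeight a b r B = if specials r B ≡ᵇ 0 then a (length B) else b (length B)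

admissible : ℕ → ℕ → List (List ℕ) → Bool
admissible K r p = (length p ≡ᵇ K) ∧ foldr (λ B acc → (specials r B ≤ᵇ 1) ∧ acc) true p

rBell : ℕ → ℕ → ℕ → (ℕ → ℚ) → (ℕ → ℚ) → ℚ
rBell r N K a b =
  sumℚ (map (λ p → if admissible K r p then prodℚ (map (blockWeight a b r) p) else 0ℚ)
            (setPartitions N))

sumFromTo : ℕ → ℕ → (ℕ → ℚ) → ℚ
sumFromTo k n f = sumℚ (map (λ i → f (k ℕ.+ i)) (upTo (suc n ∸ k)))

{-# OPTIONS --safe #-}
module Submission where

-- Both sides are coefficients of exponential generating functions.  Put
-- â = Σ_{m≥1} a_m t^m/m! and β = Σ_e b_{e+1} t^e/e!.  Expanding the divided power
-- â^k/k! multinomially gives B_{j,k}(a) = j! [t^j] â^k/k!, and since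
-- Σ_l l b_l t^l/l! = t β, also B_{N-j,r}(l b_l) = (N-j)!/r! [t^{N-j-r}] β^r.
-- On the left, set partitions are grown one element at a time.  The r special
-- elements are forced into r singletons, each contributing β; afterwards a new
-- element either joins a block, which differentiates that block's generating
-- function, or opens one of the blocks still missing, which differentiates the
-- divided power of â counting them.  This gives
-- B^{(r)}_{n+r,k+r}(a;b) = n! [t^n] (β^r · â^k/k!), and the Cauchy product formula
-- for that coefficient is the claimed identity once the factorials are cleared by
-- C(n+r,j) j! (n+r-j)! = (n+r)! = C(n+r,r) r! n!.

open import Defs

module GeneratingFunctions where

  open import Data.Bool using (Bool; true; false; if_then_else_; _∧_)
  open import Data.Bool.Properties using (∧-comm; ∧-zeroʳ; ∧-commutativeMonoid; if-∧; if-float; if-cong₂; T-≡)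
  open import Algebra.Bundles using (CommutativeMonoid)
  open import Algebra.Properties.CommutativeSemigroup (CommutativeMonoid.commutativeSemigroup ∧-commutativeMonoid)
    using () renaming (interchange to ∧-interchange)
  import Data.Integer as ℤ
  import Data.Integer.Properties as ℤ
  open import Data.List using (List; []; _∷_; map; _++_; concatMap; length; upTo; applyUpTo; foldr)
  open import Data.List.Relation.Unary.All as All using (All; []; _∷_)
  open import Data.List.Relation.Unary.All.Properties as All using ()
  open import Data.Maybe using (Maybe; just; nothing)
  open import Data.Nat as ℕ using (ℕ; zero; suc; _∸_; _≡ᵇ_; _≤ᵇ_; _!; NonZero)
  import Data.Nat.Properties as ℕ
  open import Data.Nat.Combinatorics using (_C_; nCk≡n!/k![n-k]!; k![n∸k]!∣n!)
  open import Data.Nat.DivMod using (m/n*n≡m)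
  open import Data.Nat.Coprimality using (1-coprimeTo) renaming (sym to coprime-sym)
  open import Data.Product using (_×_; _,_)
  open import Data.Sum using (_⊎_; inj₁; inj₂)
  open import Data.Rational using (ℚ; mkℚ; 0ℚ; 1ℚ; _+_; _*_; _/_; _≟_)
  open import Data.Rational.Properties
    using (+-*-commutativeRing; normalize-coprime; *-inverseˡ; +-identityˡ; +-identityʳ; *-identityˡ; *-identityʳ;
           *-zeroˡ; *-zeroʳ; *-comm; *-assoc; +-comm; +-assoc; *-distribˡ-+; *-distribʳ-+)
  open import Function using (_∘_; id)
  open import Function.Bundles using (Equivalence)
  open import Level using (0ℓ)
  open import Relation.Binary.PropositionalEquality hiding ([_])
  import Relation.Binary.Reasoning.Setoid as SetoidReasoning
  open import Relation.Binary.Bundles using (Setoid)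
  open import Relation.Nullary using (yes; no; contradiction)
  import Tactic.RingSolver.Core.AlmostCommutativeRing as ACR
  open import Tactic.RingSolver using (solve-∀)

  ℚ-ring : ACR.AlmostCommutativeRing 0ℓ 0ℓ
  ℚ-ring = ACR.fromCommutativeRing +-*-commutativeRing 0≟
    where
    0≟ : (x : ℚ) → Maybe (0ℚ ≡ x)
    0≟ x with 0ℚ ≟ x
    ... | yes p = just p
    ... | no _ = nothing

  ℕtoℚ-mkℚ : ∀ m → ℕtoℚ m ≡ mkℚ (ℤ.+ m) 0 (coprime-sym (1-coprimeTo m))
  ℕtoℚ-mkℚ m = normalize-coprime (coprime-sym (1-coprimeTo m))

  ℕtoℚ-+ : ∀ m n → ℕtoℚ (m ℕ.+ n) ≡ ℕtoℚ m + ℕtoℚ n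
  ℕtoℚ-+ m n = sym (begin
    ℕtoℚ m + ℕtoℚ n
      ≡⟨ cong₂ _+_ (ℕtoℚ-mkℚ m) (ℕtoℚ-mkℚ n) ⟩
    (ℤ.+ m ℤ.* ℤ.+ 1 ℤ.+ ℤ.+ n ℤ.* ℤ.+ 1) / 1
      ≡⟨ cong (_/ 1) (cong₂ ℤ._+_ (ℤ.*-identityʳ (ℤ.+ m)) (ℤ.*-identityʳ (ℤ.+ n))) ⟩
    ℕtoℚ (m ℕ.+ n)
      ∎)
    where open ≡-Reasoning

  ℕtoℚ-* : ∀ m n → ℕtoℚ (m ℕ.* n) ≡ ℕtoℚ m * ℕtoℚ n
  ℕtoℚ-* m n = sym (trans (cong₂ _*_ (ℕtoℚ-mkℚ m) (ℕtoℚ-mkℚ n)) (cong (_/ 1) (sym (ℤ.pos-* m n))))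

  ℕtoℚ-suc : ∀ n → ℕtoℚ (suc n) ≡ 1ℚ + ℕtoℚ n
  ℕtoℚ-suc = ℕtoℚ-+ 1

  invℕ-inverseˡ : ∀ m .{{_ : NonZero m}} → invℕ m * ℕtoℚ m ≡ 1ℚ
  invℕ-inverseˡ (suc m) =
    trans (cong₂ _*_ (normalize-coprime (1-coprimeTo (suc m))) (ℕtoℚ-mkℚ (suc m)))
          (*-inverseˡ (mkℚ (ℤ.+ suc m) 0 (coprime-sym (1-coprimeTo (suc m)))))

  invℕ-inverseʳ : ∀ m .{{_ : NonZero m}} → ℕtoℚ m * invℕ m ≡ 1ℚ
  invℕ-inverseʳ m = trans (*-comm (ℕtoℚ m) (invℕ m)) (invℕ-inverseˡ m)

  invℕ-unique : ∀ m .{{_ : NonZero m}} x → x * ℕtoℚ m ≡ 1ℚ → x ≡ invℕ m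
  invℕ-unique m x x*m≡1 = begin
    x                          ≡⟨ sym (*-identityʳ x) ⟩
    x * 1ℚ                     ≡⟨ cong (x *_) (sym (invℕ-inverseʳ m)) ⟩
    x * (ℕtoℚ m * invℕ m)      ≡⟨ sym (*-assoc x (ℕtoℚ m) (invℕ m)) ⟩
    (x * ℕtoℚ m) * invℕ m      ≡⟨ cong (_* invℕ m) x*m≡1 ⟩
    1ℚ * invℕ m                ≡⟨ *-identityˡ (invℕ m) ⟩
    invℕ m                     ∎
    where open ≡-Reasoning

  invℕ-* : ∀ m n .{{_ : NonZero m}} .{{_ : NonZero n}} → invℕ (m ℕ.* n) ≡ invℕ m * invℕ n
  invℕ-* m n = sym (invℕ-unique (m ℕ.* n) {{ℕ.m*n≢0 m n}} _ (begin
    (invℕ m * invℕ n) * ℕtoℚ (m ℕ.* n)              ≡⟨ cong ((invℕ m * invℕ n) *_) (ℕtoℚ-* m n) ⟩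
    (invℕ m * invℕ n) * (ℕtoℚ m * ℕtoℚ n)          ≡⟨ interchange (invℕ m) (invℕ n) (ℕtoℚ m) (ℕtoℚ n) ⟩
    (invℕ m * ℕtoℚ m) * (invℕ n * ℕtoℚ n)          ≡⟨ cong₂ _*_ (invℕ-inverseˡ m) (invℕ-inverseˡ n) ⟩
    1ℚ                                              ∎))
    where
    open ≡-Reasoning
    interchange : ∀ a b c d → (a * b) * (c * d) ≡ (a * c) * (b * d)
    interchange = solve-∀ ℚ-ring

  suc*invℕ-suc! : ∀ e → ℕtoℚ (suc e) * invℕ (suc e !) ≡ invℕ (e !)
  suc*invℕ-suc! e = begin
    ℕtoℚ (suc e) * invℕ (suc e ℕ.* e !)             ≡⟨ cong (ℕtoℚ (suc e) *_) (invℕ-* (suc e) (e !) {{_}} {{e ℕ.!≢0}}) ⟩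
    ℕtoℚ (suc e) * (invℕ (suc e) * invℕ (e !))      ≡⟨ sym (*-assoc (ℕtoℚ (suc e)) _ _) ⟩
    (ℕtoℚ (suc e) * invℕ (suc e)) * invℕ (e !)      ≡⟨ cong (_* invℕ (e !)) (invℕ-inverseʳ (suc e)) ⟩
    1ℚ * invℕ (e !)                                  ≡⟨ *-identityˡ (invℕ (e !)) ⟩
    invℕ (e !)                                       ∎
    where open ≡-Reasoning

  infixr 8 [_]×_
  [_]×_ : Bool → ℚ → ℚ
  [ b ]× x = if b then x else 0ℚ

  ≤ᵇ-suc : ∀ m n → (suc m ≤ᵇ suc n) ≡ (m ≤ᵇ n)
  ≤ᵇ-suc zero n = refl
  ≤ᵇ-suc (suc m) n = refl

  +-≡ᵇ : ∀ m n o → (m ℕ.+ n ≡ᵇ o) ≡ (m ≤ᵇ o) ∧ (n ≡ᵇ o ∸ m)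
  +-≡ᵇ zero n o = refl
  +-≡ᵇ (suc m) n zero = refl
  +-≡ᵇ (suc m) n (suc o) = trans (+-≡ᵇ m n o) (cong (_∧ (n ≡ᵇ o ∸ m)) (sym (≤ᵇ-suc m o)))

  ∧-false-split : ∀ x y → x ∧ y ≡ false → x ≡ false ⊎ y ≡ false
  ∧-false-split false y _ = inj₁ refl
  ∧-false-split true y y≡false = inj₂ y≡false

  ≤ᵇ-true : ∀ {m n} → m ℕ.≤ n → (m ≤ᵇ n) ≡ true
  ≤ᵇ-true m≤n = Equivalence.to T-≡ (ℕ.≤⇒≤ᵇ m≤n)

  ≤ᵇ-false : ∀ {m n} → n ℕ.< m → (m ≤ᵇ n) ≡ false
  ≤ᵇ-false {m} {n} n<m with m ≤ᵇ n | ℕ.≤ᵇ⇒≤ m n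
  ... | false | _ = refl
  ... | true | m≤n = contradiction (m≤n _) (ℕ.<⇒≱ n<m)

  []×-+ : ∀ b x y → [ b ]× x + [ b ]× y ≡ [ b ]× (x + y)
  []×-+ true x y = refl
  []×-+ false x y = +-identityˡ 0ℚ

  []×-absorb : ∀ b x y → (b ≡ false → y ≡ 0ℚ) → [ b ]× x + y ≡ [ b ]× (x + y)
  []×-absorb true x y _ = refl
  []×-absorb false x y y≡0 = trans (+-identityˡ y) (y≡0 refl)

  []×-as-* : ∀ b x → [ b ]× x ≡ x * [ b ]× 1ℚ
  []×-as-* true x = sym (*-identityʳ x)
  []×-as-* false x = sym (*-zeroʳ x)

  *-[]× : ∀ c b x → c * [ b ]× x ≡ [ b ]× (c * x)
  *-[]× c true x = refl
  *-[]× c false x = *-zeroʳ c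

  module _ {A : Set} where

    sumOver : List A → (A → ℚ) → ℚ
    sumOver xs f = sumℚ (map f xs)

    syntax sumOver xs (λ x → e) = ∑[ x ∈ xs ] e

    ∑-cong : ∀ xs {f g : A → ℚ} → f ≗ g → ∑[ x ∈ xs ] f x ≡ ∑[ x ∈ xs ] g x
    ∑-cong [] f≗g = refl
    ∑-cong (x ∷ xs) f≗g = cong₂ _+_ (f≗g x) (∑-cong xs f≗g)

    ∑-congᴬ : ∀ {xs} {f g : A → ℚ} → All (λ x → f x ≡ g x) xs → ∑[ x ∈ xs ] f x ≡ ∑[ x ∈ xs ] g x
    ∑-congᴬ [] = refl
    ∑-congᴬ (fx≡gx ∷ eqs) = cong₂ _+_ fx≡gx (∑-congᴬ eqs)

    ∑-zero : ∀ xs → ∑[ x ∈ xs ] 0ℚ ≡ 0ℚ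
    ∑-zero [] = refl
    ∑-zero (x ∷ xs) = trans (+-identityˡ _) (∑-zero xs)

    ∑-++ : ∀ xs ys (f : A → ℚ) → ∑[ x ∈ xs ++ ys ] f x ≡ ∑[ x ∈ xs ] f x + ∑[ y ∈ ys ] f y
    ∑-++ [] ys f = sym (+-identityˡ _)
    ∑-++ (x ∷ xs) ys f = trans (cong (f x +_) (∑-++ xs ys f)) (sym (+-assoc (f x) _ _))

    ∑-distrib-+ : ∀ xs (f g : A → ℚ) → ∑[ x ∈ xs ] (f x + g x) ≡ ∑[ x ∈ xs ] f x + ∑[ x ∈ xs ] g x
    ∑-distrib-+ [] f g = sym (+-identityˡ 0ℚ)
    ∑-distrib-+ (x ∷ xs) f g = trans (cong (f x + g x +_) (∑-distrib-+ xs f g)) (shuffle (f x) (g x) _ _)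
      where
      shuffle : ∀ a b c d → (a + b) + (c + d) ≡ (a + c) + (b + d)
      shuffle = solve-∀ ℚ-ring

    *-∑ : ∀ c xs (f : A → ℚ) → c * ∑[ x ∈ xs ] f x ≡ ∑[ x ∈ xs ] (c * f x)
    *-∑ c [] f = *-zeroʳ c
    *-∑ c (x ∷ xs) f = trans (*-distribˡ-+ c (f x) _) (cong (c * f x +_) (*-∑ c xs f))

    ∑-[]×-false : ∀ {xs} (c : A → Bool) (f : A → ℚ) → All (λ x → c x ≡ false) xs → ∑[ x ∈ xs ] ([ c x ]× f x) ≡ 0ℚ
    ∑-[]×-false {xs} c f cx≡false =
      trans (∑-congᴬ (All.map (λ {x} eq → cong (λ b → [ b ]× f x) eq) cx≡false)) (∑-zero xs)

    []×-∑ : ∀ b xs (f : A → ℚ) → [ b ]× ∑[ x ∈ xs ] f x ≡ ∑[ x ∈ xs ] ([ b ]× f x)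
    []×-∑ true xs f = refl
    []×-∑ false xs f = sym (∑-zero xs)

  module _ {A B : Set} where

    ∑-map : ∀ (g : A → B) xs (f : B → ℚ) → ∑[ y ∈ map g xs ] f y ≡ ∑[ x ∈ xs ] f (g x)
    ∑-map g [] f = refl
    ∑-map g (x ∷ xs) f = cong (f (g x) +_) (∑-map g xs f)

    ∑-concatMap : ∀ (g : A → List B) xs (f : B → ℚ) →
                  ∑[ y ∈ concatMap g xs ] f y ≡ ∑[ x ∈ xs ] ∑[ y ∈ g x ] f y
    ∑-concatMap g [] f = refl
    ∑-concatMap g (x ∷ xs) f = trans (∑-++ (g x) (concatMap g xs) f) (cong (∑[ y ∈ g x ] f y +_) (∑-concatMap g xs f))

    ∑-comm : ∀ xs ys (F : A → B → ℚ) → ∑[ x ∈ xs ] ∑[ y ∈ ys ] F x y ≡ ∑[ y ∈ ys ] ∑[ x ∈ xs ] F x y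
    ∑-comm [] ys F = sym (∑-zero ys)
    ∑-comm (x ∷ xs) ys F =
      trans (cong (∑[ y ∈ ys ] F x y +_) (∑-comm xs ys F)) (sym (∑-distrib-+ ys (F x) (λ y → ∑[ x ∈ xs ] F x y)))

  sumBelow : ℕ → (ℕ → ℚ) → ℚ
  sumBelow zero h = 0ℚ
  sumBelow (suc N) h = h 0 + sumBelow N (h ∘ suc)

  syntax sumBelow N (λ i → e) = ∑[ i < N ] e

  sumBelow-cong : ∀ N {f g : ℕ → ℚ} → (∀ i → i ℕ.< N → f i ≡ g i) → ∑[ i < N ] f i ≡ ∑[ i < N ] g i
  sumBelow-cong zero f≡g = refl
  sumBelow-cong (suc N) f≡g = cong₂ _+_ (f≡g 0 ℕ.z<s) (sumBelow-cong N (λ i i<N → f≡g (suc i) (ℕ.s<s i<N)))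

  sumBelow-zero : ∀ N → ∑[ i < N ] 0ℚ ≡ 0ℚ
  sumBelow-zero zero = refl
  sumBelow-zero (suc N) = trans (+-identityˡ _) (sumBelow-zero N)

  *-sumBelow : ∀ c N (f : ℕ → ℚ) → c * ∑[ i < N ] f i ≡ ∑[ i < N ] (c * f i)
  *-sumBelow c zero f = *-zeroʳ c
  *-sumBelow c (suc N) f = trans (*-distribˡ-+ c (f 0) _) (cong (c * f 0 +_) (*-sumBelow c N (f ∘ suc)))

  ∑-applyUpTo : ∀ g N (f : ℕ → ℚ) → ∑[ i ∈ applyUpTo g N ] f i ≡ ∑[ i < N ] f (g i)
  ∑-applyUpTo g zero f = refl
  ∑-applyUpTo g (suc N) f = cong (f (g 0) +_) (∑-applyUpTo (g ∘ suc) N f)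

  ∑-upTo : ∀ N (f : ℕ → ℚ) → ∑[ i ∈ upTo N ] f i ≡ ∑[ i < N ] f i
  ∑-upTo = ∑-applyUpTo id

  -- Formal power series

  Series : Set
  Series = ℕ → ℚ

  open Setoid (ℕ →-setoid ℚ) using () renaming (sym to ≗-sym; trans to ≗-trans)

  infixl 6 _⊕_
  infixl 7 _∗_
  infixr 8 _·_

  tail : Series → Series
  tail f n = f (suc n)

  _⊕_ : Series → Series → Series
  (f ⊕ g) n = f n + g n

  _·_ : ℚ → Series → Series
  (c · f) n = c * f n

  𝟘 : Series
  𝟘 n = 0ℚ

  𝟙 : Series
  𝟙 zero = 1ℚ
  𝟙 (suc n) = 0ℚ

  _∗_ : Series → Series → Series
  (f ∗ g) zero = f 0 * g 0
  (f ∗ g) (suc n) = f 0 * g (suc n) + (tail f ∗ g) n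

  ⊕-cong : ∀ {f f' g g'} → f ≗ f' → g ≗ g' → f ⊕ g ≗ f' ⊕ g'
  ⊕-cong f≗f' g≗g' n = cong₂ _+_ (f≗f' n) (g≗g' n)

  ⊕-congˡ : ∀ {f f'} g → f ≗ f' → f ⊕ g ≗ f' ⊕ g
  ⊕-congˡ g f≗f' = ⊕-cong {g = g} f≗f' (λ _ → refl)

  ⊕-congʳ : ∀ f {g g'} → g ≗ g' → f ⊕ g ≗ f ⊕ g'
  ⊕-congʳ f g≗g' = ⊕-cong {f} (λ _ → refl) g≗g'

  ·-congˡ : ∀ {c d} f → c ≡ d → c · f ≗ d · f
  ·-congˡ f refl n = refl

  ·-congʳ : ∀ c {f g} → f ≗ g → c · f ≗ c · g
  ·-congʳ c f≗g n = cong (c *_) (f≗g n)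

  ∗-cong : ∀ {f f' g g'} → f ≗ f' → g ≗ g' → f ∗ g ≗ f' ∗ g'
  ∗-cong f≗f' g≗g' zero = cong₂ _*_ (f≗f' 0) (g≗g' 0)
  ∗-cong f≗f' g≗g' (suc n) = cong₂ _+_ (cong₂ _*_ (f≗f' 0) (g≗g' (suc n))) (∗-cong (f≗f' ∘ suc) g≗g' n)

  ∗-congˡ : ∀ {f f'} g → f ≗ f' → f ∗ g ≗ f' ∗ g
  ∗-congˡ g f≗f' = ∗-cong f≗f' (λ _ → refl)

  ∗-congʳ : ∀ f {g g'} → g ≗ g' → f ∗ g ≗ f ∗ g'
  ∗-congʳ f = ∗-cong (λ _ → refl)

  ·-assoc : ∀ c d f → c · d · f ≗ (c * d) · f
  ·-assoc c d f n = sym (*-assoc c d (f n))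

  ·-identity : ∀ f → 1ℚ · f ≗ f
  ·-identity f n = *-identityˡ (f n)

  ·-zero : ∀ f → 0ℚ · f ≗ 𝟘
  ·-zero f n = *-zeroˡ (f n)

  ·-distrib-+ : ∀ c d f → (c + d) · f ≗ c · f ⊕ d · f
  ·-distrib-+ c d f n = *-distribʳ-+ (f n) c d

  suc-· : ∀ i f → ℕtoℚ (suc i) · f ≗ f ⊕ ℕtoℚ i · f
  suc-· i f n =
    trans (cong (_* f n) (ℕtoℚ-suc i)) (trans (*-distribʳ-+ (f n) 1ℚ (ℕtoℚ i)) (cong (_+ ℕtoℚ i * f n) (*-identityˡ (f n))))

  ⊕-identityˡ : ∀ f → 𝟘 ⊕ f ≗ f
  ⊕-identityˡ f n = +-identityˡ (f n)

  ⊕-identityʳ : ∀ f → f ⊕ 𝟘 ≗ f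
  ⊕-identityʳ f n = +-identityʳ (f n)

  ∗-zeroˡ : ∀ f → 𝟘 ∗ f ≗ 𝟘
  ∗-zeroˡ f zero = *-zeroˡ (f 0)
  ∗-zeroˡ f (suc n) = trans (cong₂ _+_ (*-zeroˡ (f (suc n))) (∗-zeroˡ f n)) (+-identityˡ 0ℚ)

  ∗-identityˡ : ∀ f → 𝟙 ∗ f ≗ f
  ∗-identityˡ f zero = *-identityˡ (f 0)
  ∗-identityˡ f (suc n) = trans (cong₂ _+_ (*-identityˡ (f (suc n))) (∗-zeroˡ f n)) (+-identityʳ (f (suc n)))

  ∗-distribʳ-⊕ : ∀ f g h → (f ⊕ g) ∗ h ≗ f ∗ h ⊕ g ∗ h
  ∗-distribʳ-⊕ f g h zero = *-distribʳ-+ (h 0) (f 0) (g 0)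
  ∗-distribʳ-⊕ f g h (suc n) =
    trans (cong₂ _+_ (*-distribʳ-+ (h (suc n)) (f 0) (g 0)) (∗-distribʳ-⊕ (tail f) (tail g) h n))
          (shuffle (f 0 * h (suc n)) _ _ _)
    where
    shuffle : ∀ a b c d → (a + b) + (c + d) ≡ (a + c) + (b + d)
    shuffle = solve-∀ ℚ-ring

  ·-∗ : ∀ c f g → (c · f) ∗ g ≗ c · (f ∗ g)
  ·-∗ c f g zero = *-assoc c (f 0) (g 0)
  ·-∗ c f g (suc n) =
    trans (cong₂ _+_ (*-assoc c (f 0) (g (suc n))) (·-∗ c (tail f) g n))
          (sym (*-distribˡ-+ c (f 0 * g (suc n)) _))

  ∗-suc : ∀ f g n → (f ∗ g) (suc n) ≡ (f ∗ tail g) n + f (suc n) * g 0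
  ∗-suc f g zero = refl
  ∗-suc f g (suc n) =
    trans (cong (f 0 * g (suc (suc n)) +_) (∗-suc (tail f) g n)) (sym (+-assoc (f 0 * g (suc (suc n))) _ _))

  ∗-comm : ∀ f g → f ∗ g ≗ g ∗ f
  ∗-comm f g zero = *-comm (f 0) (g 0)
  ∗-comm f g (suc n) = begin
    f 0 * g (suc n) + (tail f ∗ g) n    ≡⟨ cong (f 0 * g (suc n) +_) (∗-comm (tail f) g n) ⟩
    f 0 * g (suc n) + (g ∗ tail f) n    ≡⟨ +-comm (f 0 * g (suc n)) _ ⟩
    (g ∗ tail f) n + f 0 * g (suc n)    ≡⟨ cong ((g ∗ tail f) n +_) (*-comm (f 0) (g (suc n))) ⟩
    (g ∗ tail f) n + g (suc n) * f 0    ≡⟨ sym (∗-suc g f n) ⟩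
    (g ∗ f) (suc n)                     ∎
    where open ≡-Reasoning

  ∗-assoc : ∀ f g h → (f ∗ g) ∗ h ≗ f ∗ (g ∗ h)
  ∗-assoc f g h zero = *-assoc (f 0) (g 0) (h 0)
  ∗-assoc f g h (suc n) = begin
    (f 0 * g 0) * h (suc n) + ((f 0 · tail g ⊕ tail f ∗ g) ∗ h) n
      ≡⟨ cong ((f 0 * g 0) * h (suc n) +_) (∗-distribʳ-⊕ (f 0 · tail g) (tail f ∗ g) h n) ⟩
    (f 0 * g 0) * h (suc n) + (((f 0 · tail g) ∗ h) n + ((tail f ∗ g) ∗ h) n)
      ≡⟨ cong₂ (λ u v → (f 0 * g 0) * h (suc n) + (u + v)) (·-∗ (f 0) (tail g) h n) (∗-assoc (tail f) g h n) ⟩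
    (f 0 * g 0) * h (suc n) + (f 0 * (tail g ∗ h) n + (tail f ∗ (g ∗ h)) n)
      ≡⟨ regroup (f 0) (g 0) (h (suc n)) _ _ ⟩
    f 0 * (g 0 * h (suc n) + (tail g ∗ h) n) + (tail f ∗ (g ∗ h)) n
      ∎
    where
    open ≡-Reasoning
    regroup : ∀ a b c x y → (a * b) * c + (a * x + y) ≡ a * (b * c + x) + y
    regroup = solve-∀ ℚ-ring

  ∗-zeroʳ : ∀ f → f ∗ 𝟘 ≗ 𝟘
  ∗-zeroʳ f = ≗-trans (∗-comm f 𝟘) (∗-zeroˡ f)

  ∗-distribˡ-⊕ : ∀ f g h → f ∗ (g ⊕ h) ≗ f ∗ g ⊕ f ∗ h
  ∗-distribˡ-⊕ f g h = begin
    f ∗ (g ⊕ h)      ≈⟨ ∗-comm f (g ⊕ h) ⟩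
    (g ⊕ h) ∗ f      ≈⟨ ∗-distribʳ-⊕ g h f ⟩
    g ∗ f ⊕ h ∗ f    ≈⟨ ⊕-cong (∗-comm g f) (∗-comm h f) ⟩
    f ∗ g ⊕ f ∗ h    ∎
    where open SetoidReasoning (ℕ →-setoid ℚ)

  ∗-· : ∀ c f g → f ∗ (c · g) ≗ c · (f ∗ g)
  ∗-· c f g = begin
    f ∗ (c · g)      ≈⟨ ∗-comm f (c · g) ⟩
    (c · g) ∗ f      ≈⟨ ·-∗ c g f ⟩
    c · (g ∗ f)      ≈⟨ ·-congʳ c (∗-comm g f) ⟩
    c · (f ∗ g)      ∎
    where open SetoidReasoning (ℕ →-setoid ℚ)

  ∗-swapˡ : ∀ f g h → f ∗ (g ∗ h) ≗ g ∗ (f ∗ h)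
  ∗-swapˡ f g h = begin
    f ∗ (g ∗ h)      ≈⟨ ≗-sym (∗-assoc f g h) ⟩
    (f ∗ g) ∗ h      ≈⟨ ∗-congˡ h (∗-comm f g) ⟩
    (g ∗ f) ∗ h      ≈⟨ ∗-assoc g f h ⟩
    g ∗ (f ∗ h)      ∎
    where open SetoidReasoning (ℕ →-setoid ℚ)

  θ : Series → Series
  θ f n = ℕtoℚ n * f n

  -- The Leibniz rule is proved for the Euler operator θ = t d/dt, whose coefficients
  -- follow the recursion of ∗; the derivative ∂ is θ shifted down by one.
  ∂ : Series → Series
  ∂ f = tail (θ f)

  ∂-· : ∀ c f → ∂ (c · f) ≗ c · ∂ f
  ∂-· c f n = swap (ℕtoℚ (suc n)) c (f (suc n))
    where
    swap : ∀ a b x → a * (b * x) ≡ b * (a * x)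
    swap = solve-∀ ℚ-ring

  ∂-𝟙 : ∂ 𝟙 ≗ 𝟘
  ∂-𝟙 n = *-zeroʳ (ℕtoℚ (suc n))

  tail-θ : ∀ f → tail (θ f) ≗ tail f ⊕ θ (tail f)
  tail-θ f n = suc-· n (tail f) n

  θ-leibniz : ∀ f g → θ (f ∗ g) ≗ θ f ∗ g ⊕ f ∗ θ g
  θ-leibniz f g zero = zero-case (f 0) (g 0)
    where
    zero-case : ∀ a b → 0ℚ * (a * b) ≡ (0ℚ * a) * b + a * (0ℚ * b)
    zero-case = solve-∀ ℚ-ring
  θ-leibniz f g (suc n) = sym (begin
    ((0ℚ * f 0) * g (suc n) + (tail (θ f) ∗ g) n) + (f 0 * (ℕtoℚ (suc n) * g (suc n)) + B)
      ≡⟨ cong₂ (λ u v → ((0ℚ * f 0) * g (suc n) + u) + (f 0 * (v * g (suc n)) + B))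
               (trans (∗-congˡ g (tail-θ f) n) (∗-distribʳ-⊕ (tail f) (θ (tail f)) g n)) (ℕtoℚ-suc n) ⟩
    ((0ℚ * f 0) * g (suc n) + (C + A)) + (f 0 * ((1ℚ + N) * g (suc n)) + B)
      ≡⟨ regroup N (f 0) (g (suc n)) A B C ⟩
    (1ℚ + N) * (f 0 * g (suc n)) + C + (A + B)
      ≡⟨ cong ((1ℚ + N) * (f 0 * g (suc n)) + C +_) (sym (θ-leibniz (tail f) g n)) ⟩
    (1ℚ + N) * (f 0 * g (suc n)) + C + N * C
      ≡⟨ collect N (f 0 * g (suc n)) C ⟩
    (1ℚ + N) * (f 0 * g (suc n) + C)
      ≡⟨ cong (_* (f 0 * g (suc n) + C)) (sym (ℕtoℚ-suc n)) ⟩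
    ℕtoℚ (suc n) * (f 0 * g (suc n) + C)
      ∎)
    where
    open ≡-Reasoning
    N = ℕtoℚ n
    A = (θ (tail f) ∗ g) n
    B = (tail f ∗ θ g) n
    C = (tail f ∗ g) n
    regroup : ∀ N a b A B C → ((0ℚ * a) * b + (C + A)) + (a * ((1ℚ + N) * b) + B) ≡ (1ℚ + N) * (a * b) + C + (A + B)
    regroup = solve-∀ ℚ-ring
    collect : ∀ N x C → (1ℚ + N) * x + C + N * C ≡ (1ℚ + N) * (x + C)
    collect = solve-∀ ℚ-ring

  θ-∗-suc : ∀ f g n → (θ f ∗ g) (suc n) ≡ (∂ f ∗ g) n
  θ-∗-suc f g n = trans (cong (_+ (∂ f ∗ g) n) (trans (*-assoc 0ℚ (f 0) (g (suc n))) (*-zeroˡ (f 0 * g (suc n))))) (+-identityˡ _)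

  ∂-leibniz : ∀ f g → ∂ (f ∗ g) ≗ ∂ f ∗ g ⊕ f ∗ ∂ g
  ∂-leibniz f g n = begin
    θ (f ∗ g) (suc n)                           ≡⟨ θ-leibniz f g (suc n) ⟩
    (θ f ∗ g) (suc n) + (f ∗ θ g) (suc n)       ≡⟨ cong₂ _+_ (θ-∗-suc f g n) (∗-comm f (θ g) (suc n)) ⟩
    (∂ f ∗ g) n + (θ g ∗ f) (suc n)             ≡⟨ cong ((∂ f ∗ g) n +_) (trans (θ-∗-suc g f n) (∗-comm (∂ g) f n)) ⟩
    (∂ f ∗ g) n + (f ∗ ∂ g) n                   ∎
    where open ≡-Reasoning

  -- Divided powers

  infixr 9 _^_
  _^_ : Series → ℕ → Series
  f ^ zero = 𝟙
  f ^ suc m = f ∗ f ^ m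

  divPow : Series → ℕ → Series
  divPow f zero = 𝟙
  divPow f (suc m) = invℕ (suc m) · (f ∗ divPow f m)

  divPow-cong : ∀ {f g} m → f ≗ g → divPow f m ≗ divPow g m
  divPow-cong zero f≗g n = refl
  divPow-cong (suc m) f≗g = ·-congʳ (invℕ (suc m)) (∗-cong f≗g (divPow-cong m f≗g))

  suc·divPow-suc : ∀ f m → ℕtoℚ (suc m) · divPow f (suc m) ≗ f ∗ divPow f m
  suc·divPow-suc f m = begin
    ℕtoℚ (suc m) · invℕ (suc m) · (f ∗ divPow f m)     ≈⟨ ·-assoc (ℕtoℚ (suc m)) (invℕ (suc m)) _ ⟩
    (ℕtoℚ (suc m) * invℕ (suc m)) · (f ∗ divPow f m)   ≈⟨ ·-congˡ _ (invℕ-inverseʳ (suc m)) ⟩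
    1ℚ · (f ∗ divPow f m)                               ≈⟨ ·-identity _ ⟩
    f ∗ divPow f m                                      ∎
    where open SetoidReasoning (ℕ →-setoid ℚ)

  divPow≈pow : ∀ f m → divPow f m ≗ invℕ (m !) · f ^ m
  divPow≈pow f zero = ≗-sym (·-identity 𝟙)
  divPow≈pow f (suc m) = begin
    invℕ (suc m) · (f ∗ divPow f m)                 ≈⟨ ·-congʳ (invℕ (suc m)) (∗-congʳ f (divPow≈pow f m)) ⟩
    invℕ (suc m) · (f ∗ invℕ (m !) · f ^ m)         ≈⟨ ·-congʳ (invℕ (suc m)) (∗-· (invℕ (m !)) f (f ^ m)) ⟩
    invℕ (suc m) · invℕ (m !) · f ^ suc m           ≈⟨ ·-assoc (invℕ (suc m)) (invℕ (m !)) (f ^ suc m) ⟩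
    (invℕ (suc m) * invℕ (m !)) · f ^ suc m         ≈⟨ ·-congˡ (f ^ suc m) (sym (invℕ-* (suc m) (m !) {{_}} {{m ℕ.!≢0}})) ⟩
    invℕ (suc m ℕ.* m !) · f ^ suc m                ∎
    where open SetoidReasoning (ℕ →-setoid ℚ)

  ∂-divPow : ∀ f m → ∂ (divPow f (suc m)) ≗ ∂ f ∗ divPow f m
  ∗-∂-divPow : ∀ f m → f ∗ ∂ (divPow f m) ≗ ℕtoℚ m · (∂ f ∗ divPow f m)

  ∂-divPow f m = begin
    ∂ (divPow f (suc m))
      ≈⟨ ∂-· (invℕ (suc m)) (f ∗ divPow f m) ⟩
    invℕ (suc m) · ∂ (f ∗ divPow f m)
      ≈⟨ ·-congʳ (invℕ (suc m)) (∂-leibniz f (divPow f m)) ⟩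
    invℕ (suc m) · (X ⊕ f ∗ ∂ (divPow f m))
      ≈⟨ ·-congʳ (invℕ (suc m)) (⊕-cong (≗-sym (·-identity X)) (∗-∂-divPow f m)) ⟩
    invℕ (suc m) · (1ℚ · X ⊕ ℕtoℚ m · X)
      ≈⟨ ·-congʳ (invℕ (suc m)) (≗-sym (·-distrib-+ 1ℚ (ℕtoℚ m) X)) ⟩
    invℕ (suc m) · (1ℚ + ℕtoℚ m) · X
      ≈⟨ ·-assoc (invℕ (suc m)) (1ℚ + ℕtoℚ m) X ⟩
    (invℕ (suc m) * (1ℚ + ℕtoℚ m)) · X
      ≈⟨ ·-congˡ X (trans (cong (invℕ (suc m) *_) (sym (ℕtoℚ-suc m))) (invℕ-inverseˡ (suc m))) ⟩
    1ℚ · X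
      ≈⟨ ·-identity X ⟩
    X
      ∎
    where
    open SetoidReasoning (ℕ →-setoid ℚ)
    X = ∂ f ∗ divPow f m

  ∗-∂-divPow f zero = ≗-trans (∗-congʳ f ∂-𝟙) (≗-trans (∗-zeroʳ f) (≗-sym (·-zero (∂ f ∗ 𝟙))))
  ∗-∂-divPow f (suc m) = begin
    f ∗ ∂ (divPow f (suc m))                   ≈⟨ ∗-congʳ f (∂-divPow f m) ⟩
    f ∗ (∂ f ∗ divPow f m)                     ≈⟨ ∗-swapˡ f (∂ f) (divPow f m) ⟩
    ∂ f ∗ (f ∗ divPow f m)                     ≈⟨ ∗-congʳ (∂ f) (≗-sym (suc·divPow-suc f m)) ⟩
    ∂ f ∗ (ℕtoℚ (suc m) · divPow f (suc m))    ≈⟨ ∗-· (ℕtoℚ (suc m)) (∂ f) (divPow f (suc m)) ⟩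
    ℕtoℚ (suc m) · (∂ f ∗ divPow f (suc m))    ∎
    where open SetoidReasoning (ℕ →-setoid ℚ)

  infixr 8 t^[_]_
  t^[_]_ : ℕ → Series → Series
  t^[ zero ] f = f
  (t^[ suc k ] f) zero = 0ℚ
  (t^[ suc k ] f) (suc n) = (t^[ k ] f) n

  t^-cong : ∀ k {f g} → f ≗ g → t^[ k ] f ≗ t^[ k ] g
  t^-cong zero f≗g = f≗g
  t^-cong (suc k) f≗g zero = refl
  t^-cong (suc k) f≗g (suc n) = t^-cong k f≗g n

  t^-+ : ∀ a b f → t^[ a ℕ.+ b ] f ≗ t^[ a ] t^[ b ] f
  t^-+ zero b f n = refl
  t^-+ (suc a) b f zero = refl
  t^-+ (suc a) b f (suc n) = t^-+ a b f n

  t^-∗ : ∀ k f g → (t^[ k ] f) ∗ g ≗ t^[ k ] (f ∗ g)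
  t^-∗ zero f g n = refl
  t^-∗ (suc k) f g zero = *-zeroˡ (g 0)
  t^-∗ (suc k) f g (suc n) = trans (cong (_+ ((t^[ k ] f) ∗ g) n) (*-zeroˡ (g (suc n)))) (trans (+-identityˡ _) (t^-∗ k f g n))

  ∗-t^ : ∀ k f g → f ∗ (t^[ k ] g) ≗ t^[ k ] (f ∗ g)
  ∗-t^ k f g = ≗-trans (∗-comm f (t^[ k ] g)) (≗-trans (t^-∗ k g f) (t^-cong k (∗-comm g f)))

  ·-t^ : ∀ c k f → c · t^[ k ] f ≗ t^[ k ] c · f
  ·-t^ c zero f n = refl
  ·-t^ c (suc k) f zero = *-zeroʳ c
  ·-t^ c (suc k) f (suc n) = ·-t^ c k f n

  t^-coeff-< : ∀ k f {j} → j ℕ.< k → (t^[ k ] f) j ≡ 0ℚ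
  t^-coeff-< (suc k) f {zero} j<k = refl
  t^-coeff-< (suc k) f {suc j} (ℕ.s<s j<k) = t^-coeff-< k f j<k

  t^-coeff-+ : ∀ k f m → (t^[ k ] f) (k ℕ.+ m) ≡ f m
  t^-coeff-+ zero f m = refl
  t^-coeff-+ (suc k) f m = t^-coeff-+ k f m

  t^-coeff : ∀ k f m → (t^[ k ] f) m ≡ [ k ≤ᵇ m ]× f (m ∸ k)
  t^-coeff zero f m = refl
  t^-coeff (suc k) f zero = refl
  t^-coeff (suc k) f (suc m) = trans (t^-coeff k f m) (cong (λ b → [ b ]× f (m ∸ k)) (sym (≤ᵇ-suc k m)))

  divPow-t^ : ∀ s f v → divPow (t^[ s ] f) v ≗ t^[ v ℕ.* s ] divPow f v
  divPow-t^ s f zero n = refl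
  divPow-t^ s f (suc v) = begin
    invℕ (suc v) · (t^[ s ] f ∗ divPow (t^[ s ] f) v)      ≈⟨ ·-congʳ (invℕ (suc v)) (∗-congʳ (t^[ s ] f) (divPow-t^ s f v)) ⟩
    invℕ (suc v) · (t^[ s ] f ∗ t^[ v ℕ.* s ] E)         ≈⟨ ·-congʳ (invℕ (suc v)) (t^-∗ s f (t^[ v ℕ.* s ] E)) ⟩
    invℕ (suc v) · t^[ s ] (f ∗ t^[ v ℕ.* s ] E)         ≈⟨ ·-congʳ (invℕ (suc v)) (t^-cong s (∗-t^ (v ℕ.* s) f E)) ⟩
    invℕ (suc v) · t^[ s ] t^[ v ℕ.* s ] (f ∗ E)         ≈⟨ ·-congʳ (invℕ (suc v)) (≗-sym (t^-+ s (v ℕ.* s) (f ∗ E))) ⟩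
    invℕ (suc v) · t^[ suc v ℕ.* s ] (f ∗ E)            ≈⟨ ·-t^ (invℕ (suc v)) (suc v ℕ.* s) (f ∗ E) ⟩
    t^[ suc v ℕ.* s ] invℕ (suc v) · (f ∗ E)            ∎
    where
    open SetoidReasoning (ℕ →-setoid ℚ)
    E = divPow f v

  divPow-const : ∀ y v → divPow (y · 𝟙) v ≗ (powℚ y v * invℕ (v !)) · 𝟙
  divPow-const y zero n = sym (*-identityˡ (𝟙 n))
  divPow-const y (suc v) = begin
    invℕ (suc v) · (y · 𝟙 ∗ divPow (y · 𝟙) v)
      ≈⟨ ·-congʳ (invℕ (suc v)) (∗-congʳ (y · 𝟙) (divPow-const y v)) ⟩
    invℕ (suc v) · (y · 𝟙 ∗ c · 𝟙)
      ≈⟨ ·-congʳ (invℕ (suc v)) (≗-trans (·-∗ y 𝟙 (c · 𝟙)) (·-congʳ y (∗-identityˡ (c · 𝟙)))) ⟩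
    invℕ (suc v) · y · c · 𝟙
      ≈⟨ ≗-trans (·-congʳ (invℕ (suc v)) (·-assoc y c 𝟙)) (·-assoc (invℕ (suc v)) (y * c) 𝟙) ⟩
    (invℕ (suc v) * (y * c)) · 𝟙
      ≈⟨ ·-congˡ 𝟙 coefficient ⟩
    (powℚ y (suc v) * invℕ (suc v !)) · 𝟙
      ∎
    where
    open SetoidReasoning (ℕ →-setoid ℚ)
    c = powℚ y v * invℕ (v !)
    regroup : ∀ i y p j → i * (y * (p * j)) ≡ (y * p) * (i * j)
    regroup = solve-∀ ℚ-ring
    coefficient : invℕ (suc v) * (y * c) ≡ powℚ y (suc v) * invℕ (suc v !)
    coefficient = trans (regroup (invℕ (suc v)) y (powℚ y v) (invℕ (v !)))
                        (cong (powℚ y (suc v) *_) (sym (invℕ-* (suc v) (v !) {{_}} {{v ℕ.!≢0}})))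

  antidiagonalSum : ℕ → (ℕ → ℕ → Series) → Series
  antidiagonalSum zero h = h 0 0
  antidiagonalSum (suc K) h = h 0 (suc K) ⊕ antidiagonalSum K (λ i j → h (suc i) j)

  antidiagonalSum-cong : ∀ K {h h'} → (∀ i j → h i j ≗ h' i j) → antidiagonalSum K h ≗ antidiagonalSum K h'
  antidiagonalSum-cong zero h≗h' = h≗h' 0 0
  antidiagonalSum-cong (suc K) h≗h' = ⊕-cong (h≗h' 0 (suc K)) (antidiagonalSum-cong K (λ i j → h≗h' (suc i) j))

  antidiagonalSum-suc : ∀ K h → antidiagonalSum (suc K) h ≗ antidiagonalSum K (λ i j → h i (suc j)) ⊕ h (suc K) 0
  antidiagonalSum-suc zero h n = refl
  antidiagonalSum-suc (suc K) h n =
    trans (cong (h 0 (suc (suc K)) n +_) (antidiagonalSum-suc K (λ i j → h (suc i) j) n)) (sym (+-assoc (h 0 (suc (suc K)) n) _ _))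

  antidiagonalSum-⊕ : ∀ K g h → antidiagonalSum K (λ i j → g i j ⊕ h i j) ≗ antidiagonalSum K g ⊕ antidiagonalSum K h
  antidiagonalSum-⊕ zero g h n = refl
  antidiagonalSum-⊕ (suc K) g h n =
    trans (cong ((g 0 (suc K) ⊕ h 0 (suc K)) n +_) (antidiagonalSum-⊕ K (λ i j → g (suc i) j) (λ i j → h (suc i) j) n))
          (shuffle (g 0 (suc K) n) (h 0 (suc K) n) _ _)
    where
    shuffle : ∀ a b c d → (a + b) + (c + d) ≡ (a + c) + (b + d)
    shuffle = solve-∀ ℚ-ring

  ∗-antidiagonalSum : ∀ K f h → f ∗ antidiagonalSum K h ≗ antidiagonalSum K (λ i j → f ∗ h i j)
  ∗-antidiagonalSum zero f h n = refl
  ∗-antidiagonalSum (suc K) f h =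
    ≗-trans (∗-distribˡ-⊕ f (h 0 (suc K)) _) (⊕-congʳ (f ∗ h 0 (suc K)) (∗-antidiagonalSum K f (λ i j → h (suc i) j)))

  weighted-antidiagonalSum : ∀ K h →
    ℕtoℚ K · antidiagonalSum K h ≗ antidiagonalSum K (λ i j → ℕtoℚ i · h i j) ⊕ antidiagonalSum K (λ i j → ℕtoℚ j · h i j)
  weighted-antidiagonalSum zero h n = zero-case (h 0 0 n)
    where
    zero-case : ∀ x → 0ℚ * x ≡ 0ℚ * x + 0ℚ * x
    zero-case = solve-∀ ℚ-ring
  weighted-antidiagonalSum (suc K) h n = sym (begin
    (0ℚ * x + antidiagonalSum K (λ i j → ℕtoℚ (suc i) · h' i j) n) + (ℕtoℚ (suc K) * x + C)
      ≡⟨ cong₂ (λ u v → (0ℚ * x + u) + (v * x + C))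
               (trans (antidiagonalSum-cong K (λ i j → suc-· i (h' i j)) n) (antidiagonalSum-⊕ K h' (λ i j → ℕtoℚ i · h' i j) n))
               (ℕtoℚ-suc K) ⟩
    (0ℚ * x + (A + B)) + ((1ℚ + ℕtoℚ K) * x + C)    ≡⟨ regroup (ℕtoℚ K) x A B C ⟩
    (1ℚ + ℕtoℚ K) * x + A + (B + C)                 ≡⟨ cong ((1ℚ + ℕtoℚ K) * x + A +_) (sym (weighted-antidiagonalSum K h' n)) ⟩
    (1ℚ + ℕtoℚ K) * x + A + ℕtoℚ K * A              ≡⟨ collect (ℕtoℚ K) x A ⟩
    (1ℚ + ℕtoℚ K) * (x + A)                         ≡⟨ cong (_* (x + A)) (sym (ℕtoℚ-suc K)) ⟩
    ℕtoℚ (suc K) * (x + A)                          ∎)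
    where
    open ≡-Reasoning
    h' = λ i j → h (suc i) j
    x = h 0 (suc K) n
    A = antidiagonalSum K h' n
    B = antidiagonalSum K (λ i j → ℕtoℚ i · h' i j) n
    C = antidiagonalSum K (λ i j → ℕtoℚ j · h' i j) n
    regroup : ∀ N x A B C → (0ℚ * x + (A + B)) + ((1ℚ + N) * x + C) ≡ (1ℚ + N) * x + A + (B + C)
    regroup = solve-∀ ℚ-ring
    collect : ∀ N x A → (1ℚ + N) * x + A + N * A ≡ (1ℚ + N) * (x + A)
    collect = solve-∀ ℚ-ring

  antidiagonalSum-coeff : ∀ K h n → antidiagonalSum K h n ≡ ∑[ v < suc K ] h v (K ∸ v) n
  antidiagonalSum-coeff zero h n = sym (+-identityʳ (h 0 0 n))
  antidiagonalSum-coeff (suc K) h n = cong (h 0 (suc K) n +_) (antidiagonalSum-coeff K (λ i j → h (suc i) j) n)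

  binomialTerm : Series → Series → ℕ → ℕ → Series
  binomialTerm A B i j = divPow A i ∗ divPow B j

  ∗-∑binomialTermˡ : ∀ A B K →
    A ∗ antidiagonalSum K (binomialTerm A B) ≗ antidiagonalSum (suc K) (λ i j → ℕtoℚ i · binomialTerm A B i j)
  ∗-∑binomialTermˡ A B K = begin
    A ∗ antidiagonalSum K h                                          ≈⟨ ∗-antidiagonalSum K A h ⟩
    antidiagonalSum K (λ i j → A ∗ h i j)                            ≈⟨ antidiagonalSum-cong K (λ i j → ≗-sym (raise i j)) ⟩
    antidiagonalSum K (λ i j → ℕtoℚ (suc i) · h (suc i) j)           ≈⟨ ≗-sym (⊕-identityˡ _) ⟩
    𝟘 ⊕ antidiagonalSum K (λ i j → ℕtoℚ (suc i) · h (suc i) j)       ≈⟨ ⊕-congˡ _ (≗-sym (·-zero (h 0 (suc K)))) ⟩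
    antidiagonalSum (suc K) (λ i j → ℕtoℚ i · h i j)                 ∎
    where
    open SetoidReasoning (ℕ →-setoid ℚ)
    h = binomialTerm A B
    raise : ∀ i j → ℕtoℚ (suc i) · h (suc i) j ≗ A ∗ h i j
    raise i j = begin
      ℕtoℚ (suc i) · (divPow A (suc i) ∗ divPow B j)   ≈⟨ ≗-sym (·-∗ (ℕtoℚ (suc i)) (divPow A (suc i)) (divPow B j)) ⟩
      (ℕtoℚ (suc i) · divPow A (suc i)) ∗ divPow B j   ≈⟨ ∗-congˡ (divPow B j) (suc·divPow-suc A i) ⟩
      (A ∗ divPow A i) ∗ divPow B j                    ≈⟨ ∗-assoc A (divPow A i) (divPow B j) ⟩
      A ∗ h i j                                        ∎

  ∗-∑binomialTermʳ : ∀ A B K →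
    B ∗ antidiagonalSum K (binomialTerm A B) ≗ antidiagonalSum (suc K) (λ i j → ℕtoℚ j · binomialTerm A B i j)
  ∗-∑binomialTermʳ A B K = begin
    B ∗ antidiagonalSum K h
      ≈⟨ ∗-antidiagonalSum K B h ⟩
    antidiagonalSum K (λ i j → B ∗ h i j)
      ≈⟨ antidiagonalSum-cong K (λ i j → ≗-sym (raise i j)) ⟩
    antidiagonalSum K (λ i j → ℕtoℚ (suc j) · h i (suc j))
      ≈⟨ ≗-sym (⊕-identityʳ _) ⟩
    antidiagonalSum K (λ i j → ℕtoℚ (suc j) · h i (suc j)) ⊕ 𝟘
      ≈⟨ ⊕-congʳ (antidiagonalSum K (λ i j → ℕtoℚ (suc j) · h i (suc j))) (≗-sym (·-zero (h (suc K) 0))) ⟩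
    antidiagonalSum K (λ i j → ℕtoℚ (suc j) · h i (suc j)) ⊕ ℕtoℚ 0 · h (suc K) 0
                                                                     ≈⟨ ≗-sym (antidiagonalSum-suc K (λ i j → ℕtoℚ j · h i j)) ⟩
    antidiagonalSum (suc K) (λ i j → ℕtoℚ j · h i j)
      ∎
    where
    open SetoidReasoning (ℕ →-setoid ℚ)
    h = binomialTerm A B
    raise : ∀ i j → ℕtoℚ (suc j) · h i (suc j) ≗ B ∗ h i j
    raise i j = begin
      ℕtoℚ (suc j) · (divPow A i ∗ divPow B (suc j))   ≈⟨ ≗-sym (∗-· (ℕtoℚ (suc j)) (divPow A i) (divPow B (suc j))) ⟩
      divPow A i ∗ (ℕtoℚ (suc j) · divPow B (suc j))   ≈⟨ ∗-congʳ (divPow A i) (suc·divPow-suc B j) ⟩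
      divPow A i ∗ (B ∗ divPow B j)                    ≈⟨ ∗-swapˡ (divPow A i) B (divPow B j) ⟩
      B ∗ h i j                                        ∎

  divPow-⊕ : ∀ A B K → divPow (A ⊕ B) K ≗ antidiagonalSum K (binomialTerm A B)
  divPow-⊕ A B zero = ≗-sym (∗-identityˡ 𝟙)
  divPow-⊕ A B (suc K) = begin
    invℕ (suc K) · ((A ⊕ B) ∗ divPow (A ⊕ B) K)                 ≈⟨ ·-congʳ (invℕ (suc K)) (∗-congʳ (A ⊕ B) (divPow-⊕ A B K)) ⟩
    invℕ (suc K) · ((A ⊕ B) ∗ antidiagonalSum K h)              ≈⟨ ·-congʳ (invℕ (suc K)) (∗-distribʳ-⊕ A B _) ⟩
    invℕ (suc K) · (A ∗ antidiagonalSum K h ⊕ B ∗ antidiagonalSum K h)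
      ≈⟨ ·-congʳ (invℕ (suc K)) (⊕-cong (∗-∑binomialTermˡ A B K) (∗-∑binomialTermʳ A B K)) ⟩
    invℕ (suc K) · (antidiagonalSum (suc K) (λ i j → ℕtoℚ i · h i j) ⊕ antidiagonalSum (suc K) (λ i j → ℕtoℚ j · h i j))
      ≈⟨ ·-congʳ (invℕ (suc K)) (≗-sym (weighted-antidiagonalSum (suc K) h)) ⟩
    invℕ (suc K) · ℕtoℚ (suc K) · antidiagonalSum (suc K) h    ≈⟨ ·-assoc (invℕ (suc K)) (ℕtoℚ (suc K)) _ ⟩
    (invℕ (suc K) * ℕtoℚ (suc K)) · antidiagonalSum (suc K) h  ≈⟨ ·-congˡ _ (invℕ-inverseˡ (suc K)) ⟩
    1ℚ · antidiagonalSum (suc K) h                              ≈⟨ ·-identity _ ⟩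
    antidiagonalSum (suc K) h                                   ∎
    where
    open SetoidReasoning (ℕ →-setoid ℚ)
    h = binomialTerm A B

  ∗-coeff : ∀ f g n → (f ∗ g) n ≡ ∑[ j < suc n ] (f j * g (n ∸ j))
  ∗-coeff f g zero = sym (+-identityʳ (f 0 * g 0))
  ∗-coeff f g (suc n) = cong (f 0 * g (suc n) +_) (∗-coeff (tail f) g n)

  infix 4 _≗[≤_]_
  _≗[≤_]_ : Series → ℕ → Series → Set
  f ≗[≤ N ] g = ∀ i → i ℕ.≤ N → f i ≡ g i

  ∗-cong-≤ : ∀ {N f f' g g'} → f ≗[≤ N ] f' → g ≗[≤ N ] g' → f ∗ g ≗[≤ N ] f' ∗ g'
  ∗-cong-≤ f≗f' g≗g' zero i≤N = cong₂ _*_ (f≗f' 0 ℕ.z≤n) (g≗g' 0 ℕ.z≤n)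
  ∗-cong-≤ {suc N} f≗f' g≗g' (suc i) (ℕ.s≤s i≤N) =
    cong₂ _+_ (cong₂ _*_ (f≗f' 0 ℕ.z≤n) (g≗g' (suc i) (ℕ.s≤s i≤N)))
              (∗-cong-≤ {N} (λ j j≤N → f≗f' (suc j) (ℕ.s≤s j≤N)) (λ j j≤N → g≗g' j (ℕ.m≤n⇒m≤1+n j≤N)) i i≤N)

  divPow-cong-≤ : ∀ {N f g} m → f ≗[≤ N ] g → divPow f m ≗[≤ N ] divPow g m
  divPow-cong-≤ zero f≗g i i≤N = refl
  divPow-cong-≤ (suc m) f≗g i i≤N = cong (invℕ (suc m) *_) (∗-cong-≤ f≗g (divPow-cong-≤ m f≗g) i i≤N)

  sumBelow-≤ᵇ : ∀ K N (G : ℕ → ℚ) → K ℕ.< N → ∑[ v < N ] ([ v ≤ᵇ K ]× G v) ≡ ∑[ v < suc K ] G v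
  sumBelow-≤ᵇ zero (suc N) G K<N = cong (G 0 +_) (sumBelow-zero N)
  sumBelow-≤ᵇ (suc K) (suc N) G (ℕ.s<s K<N) = cong (G 0 +_) (begin
    ∑[ v < N ] ([ suc v ≤ᵇ suc K ]× G (suc v)) ≡⟨ sumBelow-cong N (λ v _ → cong (λ b → [ b ]× G (suc v)) (≤ᵇ-suc v K)) ⟩
    ∑[ v < N ] ([ v ≤ᵇ K ]× G (suc v))         ≡⟨ sumBelow-≤ᵇ K N (G ∘ suc) K<N ⟩
    ∑[ v < suc K ] G (suc v)                   ∎)
    where open ≡-Reasoning

  -- Partial Bell polynomials

  egf : (ℕ → ℚ) → Series
  egf x zero = 0ℚ
  egf x (suc m) = x (suc m) * invℕ (suc m !)

  egfCoeff : Series → ℕ → ℚ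
  egfCoeff f n = ℕtoℚ (n !) * f n

  ∏!≢0 : ∀ ks → NonZero (prodℕ (map _! ks))
  ∏!≢0 [] = _
  ∏!≢0 (k ∷ ks) = ℕ.m*n≢0 (k !) (prodℕ (map _! ks)) {{k ℕ.!≢0}} {{∏!≢0 ks}}

  module BellEGF (x : ℕ → ℚ) where

    y : ℕ → ℚ
    y s = x s * invℕ (s !)

    window : ℕ → ℕ → Series
    window s zero = 𝟘
    window s (suc L) = t^[ s ] (y s · 𝟙) ⊕ window (suc s) L

    -- For ks = (k_s, k_{s+1}, …) with Σ k_i = K, the coefficient of t^M in ∏ (y_i t^i)^{k_i} / k_i!:
    -- one term of the multinomial expansion of divPow (window s L) K.
    tupleTerm : ℕ → ℕ → ℕ → List ℕ → ℚ
    tupleTerm s K M ks = [ (sumℕ ks ≡ᵇ K) ∧ (wsum s ks ≡ᵇ M) ]× (invℕ (prodℕ (map _! ks)) * monom x s ks)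

    yDivPow : ℕ → ℕ → ℚ
    yDivPow s v = powℚ (y s) v * invℕ (v !)

    tupleTerm-∷ : ∀ s K M v ks →
      tupleTerm s K M (v ∷ ks) ≡ [ v ≤ᵇ K ]× [ s ℕ.* v ≤ᵇ M ]× (yDivPow s v * tupleTerm (suc s) (K ∸ v) (M ∸ s ℕ.* v) ks)
    tupleTerm-∷ s K M v ks = begin
      [ (v ℕ.+ S ≡ᵇ K) ∧ (s ℕ.* v ℕ.+ W ≡ᵇ M) ]× (invℕ (v ! ℕ.* P) * (powℚ (y s) v * m))
        ≡⟨ cong₂ [_]×_ (cong₂ _∧_ (+-≡ᵇ v S K) (+-≡ᵇ (s ℕ.* v) W M)) split-value ⟩
      [ ((v ≤ᵇ K) ∧ (S ≡ᵇ K ∸ v)) ∧ ((s ℕ.* v ≤ᵇ M) ∧ (W ≡ᵇ M ∸ s ℕ.* v)) ]× (yDivPow s v * (invℕ P * m))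
        ≡⟨ cong (λ b → [ b ]× (yDivPow s v * (invℕ P * m)))
                (∧-interchange (v ≤ᵇ K) (S ≡ᵇ K ∸ v) (s ℕ.* v ≤ᵇ M) (W ≡ᵇ M ∸ s ℕ.* v)) ⟩
      [ ((v ≤ᵇ K) ∧ (s ℕ.* v ≤ᵇ M)) ∧ ((S ≡ᵇ K ∸ v) ∧ (W ≡ᵇ M ∸ s ℕ.* v)) ]× (yDivPow s v * (invℕ P * m))
        ≡⟨ trans (if-∧ ((v ≤ᵇ K) ∧ (s ℕ.* v ≤ᵇ M))) (if-∧ (v ≤ᵇ K)) ⟩
      [ v ≤ᵇ K ]× [ s ℕ.* v ≤ᵇ M ]× [ (S ≡ᵇ K ∸ v) ∧ (W ≡ᵇ M ∸ s ℕ.* v) ]× (yDivPow s v * (invℕ P * m))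
        ≡⟨ cong (λ z → [ v ≤ᵇ K ]× [ s ℕ.* v ≤ᵇ M ]× z) (sym (*-[]× (yDivPow s v) _ (invℕ P * m))) ⟩
      [ v ≤ᵇ K ]× [ s ℕ.* v ≤ᵇ M ]× (yDivPow s v * tupleTerm (suc s) (K ∸ v) (M ∸ s ℕ.* v) ks)
        ∎
      where
      open ≡-Reasoning
      S = sumℕ ks
      W = wsum (suc s) ks
      P = prodℕ (map _! ks)
      m = monom x (suc s) ks
      regroup : ∀ i j p m → (i * j) * (p * m) ≡ (p * i) * (j * m)
      regroup = solve-∀ ℚ-ring
      split-value : invℕ (v ! ℕ.* P) * (powℚ (y s) v * m) ≡ yDivPow s v * (invℕ P * m)
      split-value = trans (cong (_* (powℚ (y s) v * m)) (invℕ-* (v !) P {{v ℕ.!≢0}} {{∏!≢0 ks}}))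
                          (regroup (invℕ (v !)) (invℕ P) (powℚ (y s) v) m)

    ∗-divPow-monomial : ∀ s v F M →
      (divPow (t^[ s ] (y s · 𝟙)) v ∗ F) M ≡ [ s ℕ.* v ≤ᵇ M ]× (yDivPow s v * F (M ∸ s ℕ.* v))
    ∗-divPow-monomial s v F M = begin
      (divPow (t^[ s ] (y s · 𝟙)) v ∗ F) M
        ≡⟨ ∗-congˡ F (≗-trans (divPow-t^ s (y s · 𝟙) v) (t^-cong (v ℕ.* s) (divPow-const (y s) v))) M ⟩
      (t^[ v ℕ.* s ] (yDivPow s v · 𝟙) ∗ F) M
        ≡⟨ t^-∗ (v ℕ.* s) (yDivPow s v · 𝟙) F M ⟩
      (t^[ v ℕ.* s ] (yDivPow s v · 𝟙 ∗ F)) M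
        ≡⟨ t^-cong (v ℕ.* s) (≗-trans (·-∗ (yDivPow s v) 𝟙 F) (·-congʳ (yDivPow s v) (∗-identityˡ F))) M ⟩
      (t^[ v ℕ.* s ] (yDivPow s v · F)) M
        ≡⟨ t^-coeff (v ℕ.* s) (yDivPow s v · F) M ⟩
      [ v ℕ.* s ≤ᵇ M ]× (yDivPow s v * F (M ∸ v ℕ.* s))
        ≡⟨ cong (λ w → [ w ≤ᵇ M ]× (yDivPow s v * F (M ∸ w))) (ℕ.*-comm v s) ⟩
      [ s ℕ.* v ≤ᵇ M ]× (yDivPow s v * F (M ∸ s ℕ.* v))
        ∎
      where open ≡-Reasoning

    tuplesSum : ℕ → ℕ → ℕ → ℕ → Series
    tuplesSum bnd s L K M = ∑[ ks ∈ tuples L bnd ] tupleTerm s K M ks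

    tuplesSum-suc : ∀ bnd s L K M → K ℕ.≤ bnd →
      tuplesSum bnd s (suc L) K M ≡ ∑[ v < suc K ] ([ s ℕ.* v ≤ᵇ M ]× (yDivPow s v * tuplesSum bnd (suc s) L (K ∸ v) (M ∸ s ℕ.* v)))
    tuplesSum-suc bnd s L K M K≤bnd = begin
      ∑[ ks ∈ concatMap (λ t → map (_∷ t) (upTo (suc bnd))) ts ] tupleTerm s K M ks
        ≡⟨ ∑-concatMap (λ t → map (_∷ t) (upTo (suc bnd))) ts (tupleTerm s K M) ⟩
      ∑[ t ∈ ts ] ∑[ ks ∈ map (_∷ t) (upTo (suc bnd)) ] tupleTerm s K M ks
        ≡⟨ ∑-cong ts (λ t → ∑-map (_∷ t) (upTo (suc bnd)) (tupleTerm s K M)) ⟩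
      ∑[ t ∈ ts ] ∑[ v ∈ upTo (suc bnd) ] tupleTerm s K M (v ∷ t)
        ≡⟨ ∑-comm ts (upTo (suc bnd)) (λ t v → tupleTerm s K M (v ∷ t)) ⟩
      ∑[ v ∈ upTo (suc bnd) ] ∑[ t ∈ ts ] tupleTerm s K M (v ∷ t)
        ≡⟨ ∑-cong (upTo (suc bnd)) (λ v → trans (∑-cong ts (tupleTerm-∷ s K M v)) (factor-out v)) ⟩
      ∑[ v ∈ upTo (suc bnd) ] ([ v ≤ᵇ K ]× G v)
        ≡⟨ ∑-upTo (suc bnd) (λ v → [ v ≤ᵇ K ]× G v) ⟩
      ∑[ v < suc bnd ] ([ v ≤ᵇ K ]× G v)
        ≡⟨ sumBelow-≤ᵇ K (suc bnd) G (ℕ.s≤s K≤bnd) ⟩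
      ∑[ v < suc K ] G v
        ∎
      where
      open ≡-Reasoning
      ts = tuples L bnd
      G : ℕ → ℚ
      G v = [ s ℕ.* v ≤ᵇ M ]× (yDivPow s v * tuplesSum bnd (suc s) L (K ∸ v) (M ∸ s ℕ.* v))
      factor-out : ∀ v → ∑[ t ∈ ts ] ([ v ≤ᵇ K ]× [ s ℕ.* v ≤ᵇ M ]× (yDivPow s v * tupleTerm (suc s) (K ∸ v) (M ∸ s ℕ.* v) t))
                         ≡ [ v ≤ᵇ K ]× G v
      factor-out v = sym (begin
        [ v ≤ᵇ K ]× [ s ℕ.* v ≤ᵇ M ]× (yDivPow s v * tuplesSum bnd (suc s) L (K ∸ v) (M ∸ s ℕ.* v))
          ≡⟨ cong (λ z → [ v ≤ᵇ K ]× [ s ℕ.* v ≤ᵇ M ]× z) (*-∑ (yDivPow s v) ts (tupleTerm (suc s) (K ∸ v) (M ∸ s ℕ.* v))) ⟩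
        [ v ≤ᵇ K ]× [ s ℕ.* v ≤ᵇ M ]× ∑[ t ∈ ts ] (yDivPow s v * tupleTerm (suc s) (K ∸ v) (M ∸ s ℕ.* v) t)
          ≡⟨ cong [ v ≤ᵇ K ]×_ ([]×-∑ (s ℕ.* v ≤ᵇ M) ts _) ⟩
        [ v ≤ᵇ K ]× ∑[ t ∈ ts ] ([ s ℕ.* v ≤ᵇ M ]× (yDivPow s v * tupleTerm (suc s) (K ∸ v) (M ∸ s ℕ.* v) t))
          ≡⟨ []×-∑ (v ≤ᵇ K) ts _ ⟩
        ∑[ t ∈ ts ] ([ v ≤ᵇ K ]× [ s ℕ.* v ≤ᵇ M ]× (yDivPow s v * tupleTerm (suc s) (K ∸ v) (M ∸ s ℕ.* v) t))
          ∎)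

    tuplesSum≗divPow : ∀ bnd L s K → K ℕ.≤ bnd → tuplesSum bnd s L K ≗ divPow (window s L) K
    tuplesSum≗divPow bnd zero s zero K≤bnd zero = refl
    tuplesSum≗divPow bnd zero s zero K≤bnd (suc M) = refl
    tuplesSum≗divPow bnd zero s (suc K) K≤bnd M =
      sym (trans (cong (invℕ (suc K) *_) (∗-zeroˡ (divPow 𝟘 K) M)) (*-zeroʳ (invℕ (suc K))))
    tuplesSum≗divPow bnd (suc L) s K K≤bnd M = begin
      tuplesSum bnd s (suc L) K M
        ≡⟨ tuplesSum-suc bnd s L K M K≤bnd ⟩
      ∑[ v < suc K ] ([ s ℕ.* v ≤ᵇ M ]× (yDivPow s v * tuplesSum bnd (suc s) L (K ∸ v) (M ∸ s ℕ.* v)))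
        ≡⟨ sumBelow-cong (suc K) (λ v _ → trans (cong (λ z → [ s ℕ.* v ≤ᵇ M ]× (yDivPow s v * z)) (IH v))
                                                (sym (∗-divPow-monomial s v (divPow W (K ∸ v)) M))) ⟩
      ∑[ v < suc K ] (divPow (t^[ s ] (y s · 𝟙)) v ∗ divPow W (K ∸ v)) M
        ≡⟨ sym (antidiagonalSum-coeff K (binomialTerm (t^[ s ] (y s · 𝟙)) W) M) ⟩
      antidiagonalSum K (binomialTerm (t^[ s ] (y s · 𝟙)) W) M
        ≡⟨ sym (divPow-⊕ (t^[ s ] (y s · 𝟙)) W K M) ⟩
      divPow (window s (suc L)) K M
        ∎
      where
      open ≡-Reasoning
      W = window (suc s) L
      IH : ∀ v → tuplesSum bnd (suc s) L (K ∸ v) (M ∸ s ℕ.* v) ≡ divPow W (K ∸ v) (M ∸ s ℕ.* v)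
      IH v = tuplesSum≗divPow bnd L (suc s) (K ∸ v) (ℕ.≤-trans (ℕ.m∸n≤m K v) K≤bnd) (M ∸ s ℕ.* v)

    window-below : ∀ L s i → i ℕ.< s → window s L i ≡ 0ℚ
    window-below zero s i i<s = refl
    window-below (suc L) s i i<s =
      trans (cong₂ _+_ (t^-coeff-< s (y s · 𝟙) i<s) (window-below L (suc s) i (ℕ.m<n⇒m<1+n i<s))) (+-identityˡ 0ℚ)

    window-inside : ∀ L s j → j ℕ.< L → window s L (s ℕ.+ j) ≡ y (s ℕ.+ j)
    window-inside (suc L) s zero _ = begin
      (t^[ s ] (y s · 𝟙)) (s ℕ.+ 0) + window (suc s) L (s ℕ.+ 0)
        ≡⟨ cong₂ _+_ (t^-coeff-+ s (y s · 𝟙) 0) (window-below L (suc s) (s ℕ.+ 0) (ℕ.s≤s (ℕ.≤-reflexive (ℕ.+-identityʳ s)))) ⟩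
      y s * 1ℚ + 0ℚ
        ≡⟨ trans (+-identityʳ _) (*-identityʳ (y s)) ⟩
      y s
        ≡⟨ cong y (sym (ℕ.+-identityʳ s)) ⟩
      y (s ℕ.+ 0)
        ∎
      where open ≡-Reasoning
    window-inside (suc L) s (suc j) (ℕ.s<s j<L) = begin
      (t^[ s ] (y s · 𝟙)) (s ℕ.+ suc j) + window (suc s) L (s ℕ.+ suc j)
        ≡⟨ cong₂ _+_ (t^-coeff-+ s (y s · 𝟙) (suc j)) (cong (window (suc s) L) (ℕ.+-suc s j)) ⟩
      y s * 0ℚ + window (suc s) L (suc s ℕ.+ j)
        ≡⟨ cong₂ _+_ (*-zeroʳ (y s)) (window-inside L (suc s) j j<L) ⟩
      0ℚ + y (suc s ℕ.+ j)
        ≡⟨ trans (+-identityˡ _) (cong y (sym (ℕ.+-suc s j))) ⟩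
      y (s ℕ.+ suc j)
        ∎
      where open ≡-Reasoning

    window≗egf : ∀ n → window 1 n ≗[≤ n ] egf x
    window≗egf n zero _ = window-below n 1 0 ℕ.z<s
    window≗egf n (suc e) e<n = window-inside n 1 e e<n

    Bell≡egfCoeff : ∀ n k → Bell n k x ≡ egfCoeff (divPow (egf x) k) n
    Bell≡egfCoeff n k = begin
      ∑[ ks ∈ tuples n k ] bellTerm x n k ks
        ≡⟨ ∑-cong (tuples n k) bellTerm≡ ⟩
      ∑[ ks ∈ tuples n k ] (ℕtoℚ (n !) * tupleTerm 1 k n ks)
        ≡⟨ sym (*-∑ (ℕtoℚ (n !)) (tuples n k) (tupleTerm 1 k n)) ⟩
      ℕtoℚ (n !) * tuplesSum k 1 n k n
        ≡⟨ cong (ℕtoℚ (n !) *_) (tuplesSum≗divPow k n 1 k ℕ.≤-refl n) ⟩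
      ℕtoℚ (n !) * divPow (window 1 n) k n
        ≡⟨ cong (ℕtoℚ (n !) *_) (divPow-cong-≤ k (window≗egf n) n ℕ.≤-refl) ⟩
      ℕtoℚ (n !) * divPow (egf x) k n
        ∎
      where
      open ≡-Reasoning
      bellTerm≡ : ∀ ks → bellTerm x n k ks ≡ ℕtoℚ (n !) * tupleTerm 1 k n ks
      bellTerm≡ ks = trans (cong (λ z → [ (sumℕ ks ≡ᵇ k) ∧ (wsum 1 ks ≡ᵇ n) ]× z) (*-assoc (ℕtoℚ (n !)) _ _))
                           (sym (*-[]× (ℕtoℚ (n !)) _ _))

  -- Partial r-Bell polynomials

  egfFrom : (ℕ → ℚ) → ℕ → Series
  egfFrom c s e = c (s ℕ.+ e) * invℕ (e !)

  egfFrom-0 : ∀ c s → egfFrom c s 0 ≡ c s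
  egfFrom-0 c s = trans (*-identityʳ (c (s ℕ.+ 0))) (cong c (ℕ.+-identityʳ s))

  ∂-egfFrom : ∀ c s → ∂ (egfFrom c s) ≗ egfFrom c (suc s)
  ∂-egfFrom c s e = begin
    ℕtoℚ (suc e) * (c (s ℕ.+ suc e) * invℕ (suc e !))   ≡⟨ swap (ℕtoℚ (suc e)) (c (s ℕ.+ suc e)) _ ⟩
    c (s ℕ.+ suc e) * (ℕtoℚ (suc e) * invℕ (suc e !))   ≡⟨ cong₂ _*_ (cong c (ℕ.+-suc s e)) (suc*invℕ-suc! e) ⟩
    c (suc s ℕ.+ e) * invℕ (e !)                        ∎
    where
    open ≡-Reasoning
    swap : ∀ a b c → a * (b * c) ≡ b * (a * c)
    swap = solve-∀ ℚ-ring

  ∂-egf : ∀ c → ∂ (egf c) ≗ egfFrom c 1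
  ∂-egf c e = trans (swap (ℕtoℚ (suc e)) (c (suc e)) _) (cong (c (suc e) *_) (suc*invℕ-suc! e))
    where
    swap : ∀ a b c → a * (b * c) ≡ b * (a * c)
    swap = solve-∀ ℚ-ring

  egf-*index : ∀ c → egf (λ l → ℕtoℚ l * c l) ≗ t^[ 1 ] egfFrom c 1
  egf-*index c zero = refl
  egf-*index c (suc e) = trans (*-assoc (ℕtoℚ (suc e)) (c (suc e)) _) (∂-egf c e)

  egfCoeff-cong : ∀ {f g} → f ≗ g → ∀ n → egfCoeff f n ≡ egfCoeff g n
  egfCoeff-cong f≗g n = cong (ℕtoℚ (n !) *_) (f≗g n)

  egfCoeff-suc : ∀ f n → egfCoeff f (suc n) ≡ egfCoeff (∂ f) n
  egfCoeff-suc f n = trans (cong (_* f (suc n)) (ℕtoℚ-* (suc n) (n !))) (regroup (ℕtoℚ (suc n)) (ℕtoℚ (n !)) (f (suc n)))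
    where
    regroup : ∀ a b c → (a * b) * c ≡ b * (a * c)
    regroup = solve-∀ ℚ-ring

  -- [L ≤ K] · A ^ (K - L) / (K - L)!, without truncated subtraction: once L blocks exist,
  -- it counts the K - L blocks still to be opened by elements not yet placed.
  newBlocks : Series → ℕ → ℕ → Series
  newBlocks A K zero = divPow A K
  newBlocks A zero (suc L) = 𝟘
  newBlocks A (suc K) (suc L) = newBlocks A K L

  newBlocks-+ : ∀ A r k → newBlocks A (r ℕ.+ k) r ≡ divPow A k
  newBlocks-+ A zero k = refl
  newBlocks-+ A (suc r) k = newBlocks-+ A r k

  ∂-newBlocks : ∀ A K L → ∂ (newBlocks A K L) ≗ ∂ A ∗ newBlocks A K (suc L)
  ∂-newBlocks A zero zero = ≗-trans ∂-𝟙 (≗-sym (∗-zeroʳ (∂ A)))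
  ∂-newBlocks A (suc K) zero = ∂-divPow A K
  ∂-newBlocks A zero (suc L) n = trans (*-zeroʳ (ℕtoℚ (suc n))) (sym (∗-zeroʳ (∂ A) n))
  ∂-newBlocks A (suc K) (suc L) = ∂-newBlocks A K L

  newBlocks-egf-0 : ∀ x K L → newBlocks (egf x) K L 0 ≡ [ L ≡ᵇ K ]× 1ℚ
  newBlocks-egf-0 x zero zero = refl
  newBlocks-egf-0 x (suc K) zero = trans (cong (invℕ (suc K) *_) (*-zeroˡ (divPow (egf x) K 0))) (*-zeroʳ (invℕ (suc K)))
  newBlocks-egf-0 x zero (suc L) = refl
  newBlocks-egf-0 x (suc K) (suc L) = newBlocks-egf-0 x K L

  singletons : ℕ → List (List ℕ)
  singletons zero = []
  singletons (suc j) = (j ∷ []) ∷ singletons j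

  length-singletons : ∀ j → length (singletons j) ≡ j
  length-singletons zero = refl
  length-singletons (suc j) = cong suc (length-singletons j)

  module RBellEGF (a b : ℕ → ℚ) (r K : ℕ) where

    separated : List (List ℕ) → Bool
    separated = foldr (λ B acc → (specials r B ≤ᵇ 1) ∧ acc) true

    weight : List (List ℕ) → ℚ
    weight p = [ admissible K r p ]× prodℚ (map (blockWeight a b r) p)

    -- The total weight of the partitions of {0, …, M + R - 1} that restrict to p on {0, …, M - 1}.
    extensionWeight : List (List ℕ) → ℕ → ℕ → ℚ
    extensionWeight p M zero = weight p
    extensionWeight p M (suc R) =
      extensionWeight ((M ∷ []) ∷ p) (suc M) R + ∑[ q ∈ insertEach M p ] extensionWeight q (suc M) R

    ∑-setPartitions-+ : ∀ R M → ∑[ p ∈ setPartitions (M ℕ.+ R) ] weight p ≡ ∑[ p ∈ setPartitions M ] extensionWeight p M R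
    ∑-setPartitions-+ zero M rewrite ℕ.+-identityʳ M = refl
    ∑-setPartitions-+ (suc R) M rewrite ℕ.+-suc M R =
      trans (∑-setPartitions-+ R (suc M))
            (∑-concatMap (λ p → ((M ∷ []) ∷ p) ∷ insertEach M p) (setPartitions M) (λ p → extensionWeight p (suc M) R))

    -- A block of size s, of weight c_s with c = a or b, gets weight c_{s+e} once e new elements join it.
    blockEGF : List ℕ → Series
    blockEGF B = egfFrom (if specials r B ≡ᵇ 0 then a else b) (length B)

    blocksEGF : List (List ℕ) → Series
    blocksEGF [] = 𝟙
    blocksEGF (B ∷ p) = blockEGF B ∗ blocksEGF p

    freshBlocks : ℕ → Series
    freshBlocks = newBlocks (egf a) K

    specials-∷ : ∀ m B → specials r (m ∷ B) ≡ (if suc m ≤ᵇ r then suc (specials r B) else specials r B)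
    specials-∷ m B with suc m ≤ᵇ r
    ... | true = refl
    ... | false = refl

    specials-∷-≥ : ∀ {m} B → r ℕ.≤ m → specials r (m ∷ B) ≡ specials r B
    specials-∷-≥ {m} B r≤m =
      trans (specials-∷ m B) (cong (λ c → if c then suc (specials r B) else specials r B) (≤ᵇ-false (ℕ.s≤s r≤m)))

    specials-∷-< : ∀ {m} B → m ℕ.< r → specials r (m ∷ B) ≡ suc (specials r B)
    specials-∷-< {m} B m<r =
      trans (specials-∷ m B) (cong (λ c → if c then suc (specials r B) else specials r B) (≤ᵇ-true m<r))

    singleton-separated : ∀ m → (specials r (m ∷ []) ≤ᵇ 1) ≡ true
    singleton-separated m with suc m ≤ᵇ r
    ... | true = refl
    ... | false = refl

    blockEGF-∷-≥ : ∀ {M} B → r ℕ.≤ M → blockEGF (M ∷ B) ≗ ∂ (blockEGF B)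
    blockEGF-∷-≥ B r≤M e =
      trans (cong (λ s → egfFrom (if s ≡ᵇ 0 then a else b) (suc (length B)) e) (specials-∷-≥ B r≤M))
            (sym (∂-egfFrom (if specials r B ≡ᵇ 0 then a else b) (length B) e))

    blockEGF-new : ∀ {M} → r ℕ.≤ M → blockEGF (M ∷ []) ≗ egfFrom a 1
    blockEGF-new r≤M e = cong (λ s → egfFrom (if s ≡ᵇ 0 then a else b) 1 e) (specials-∷-≥ [] r≤M)

    blocksEGF-0 : ∀ p → blocksEGF p 0 ≡ prodℚ (map (blockWeight a b r) p)
    blocksEGF-0 [] = refl
    blocksEGF-0 (B ∷ p) = cong₂ _*_ block-0 (blocksEGF-0 p)
      where
      block-0 : blockEGF B 0 ≡ blockWeight a b r B
      block-0 = trans (if-float (λ c → egfFrom c (length B) 0) (specials r B ≡ᵇ 0))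
                      (if-cong₂ (specials r B ≡ᵇ 0) (egfFrom-0 a (length B)) (egfFrom-0 b (length B)))

    insertEach-≥ : ∀ {M} p → r ℕ.≤ M →
      All (λ q → length q ≡ length p × separated q ≡ separated p) (insertEach M p)
    insertEach-≥ [] r≤M = []
    insertEach-≥ (B ∷ bs) r≤M =
      (refl , cong (λ s → (s ≤ᵇ 1) ∧ separated bs) (specials-∷-≥ B r≤M))
      ∷ All.map⁺ (All.map (λ (|q|≡ , sep≡) → cong suc |q|≡ , cong ((specials r B ≤ᵇ 1) ∧_) sep≡) (insertEach-≥ bs r≤M))

    -- Inserting a non-special element into each block in turn differentiates the product (Leibniz rule).
    ∑-insertEach-blocksEGF : ∀ {M} → r ℕ.≤ M → ∀ p G n →
      ∑[ q ∈ insertEach M p ] (blocksEGF q ∗ G) n ≡ (∂ (blocksEGF p) ∗ G) n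
    ∑-insertEach-blocksEGF r≤M [] G n = sym (trans (∗-congˡ G ∂-𝟙 n) (∗-zeroˡ G n))
    ∑-insertEach-blocksEGF {M} r≤M (B ∷ bs) G n = begin
      (blockEGF (M ∷ B) ∗ P ∗ G) n + ∑[ q ∈ map (B ∷_) (insertEach M bs) ] (blocksEGF q ∗ G) n
        ≡⟨ cong₂ _+_ (∗-congˡ G (∗-congˡ P (blockEGF-∷-≥ B r≤M)) n)
                     (∑-map (B ∷_) (insertEach M bs) (λ q → (blocksEGF q ∗ G) n)) ⟩
      (∂ β ∗ P ∗ G) n + ∑[ q ∈ insertEach M bs ] (β ∗ blocksEGF q ∗ G) n
        ≡⟨ cong ((∂ β ∗ P ∗ G) n +_) (∑-cong (insertEach M bs) (λ q → move-β (blocksEGF q) n)) ⟩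
      (∂ β ∗ P ∗ G) n + ∑[ q ∈ insertEach M bs ] (blocksEGF q ∗ (β ∗ G)) n
        ≡⟨ cong ((∂ β ∗ P ∗ G) n +_) (trans (∑-insertEach-blocksEGF r≤M bs (β ∗ G) n) (sym (move-β (∂ P) n))) ⟩
      (∂ β ∗ P ∗ G) n + (β ∗ ∂ P ∗ G) n
        ≡⟨ sym (∗-distribʳ-⊕ (∂ β ∗ P) (β ∗ ∂ P) G n) ⟩
      ((∂ β ∗ P ⊕ β ∗ ∂ P) ∗ G) n
        ≡⟨ sym (∗-congˡ G (∂-leibniz β P) n) ⟩
      (∂ (β ∗ P) ∗ G) n
        ∎
      where
      open ≡-Reasoning
      β = blockEGF B
      P = blocksEGF bs
      move-β : ∀ Q → β ∗ Q ∗ G ≗ Q ∗ (β ∗ G)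
      move-β Q = ≗-trans (∗-congˡ G (∗-comm β Q)) (∗-assoc Q β G)

    completion-suc : ∀ P L R →
      egfCoeff (egfFrom a 1 ∗ P ∗ freshBlocks (suc L)) R + egfCoeff (∂ P ∗ freshBlocks L) R ≡ egfCoeff (P ∗ freshBlocks L) (suc R)
    completion-suc P L R = sym (begin
      egfCoeff (P ∗ freshBlocks L) (suc R)
        ≡⟨ egfCoeff-suc (P ∗ freshBlocks L) R ⟩
      R! * ∂ (P ∗ freshBlocks L) R
        ≡⟨ cong (R! *_) (∂-leibniz P (freshBlocks L) R) ⟩
      R! * ((∂ P ∗ freshBlocks L) R + (P ∗ ∂ (freshBlocks L)) R)
        ≡⟨ cong (λ z → R! * ((∂ P ∗ freshBlocks L) R + z)) (new-block R) ⟩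
      R! * ((∂ P ∗ freshBlocks L) R + (A ∗ P ∗ freshBlocks (suc L)) R)
        ≡⟨ *-distribˡ-+ R! _ _ ⟩
      egfCoeff (∂ P ∗ freshBlocks L) R + egfCoeff (A ∗ P ∗ freshBlocks (suc L)) R
                                                             ≡⟨ +-comm (egfCoeff (∂ P ∗ freshBlocks L) R) _ ⟩
      egfCoeff (A ∗ P ∗ freshBlocks (suc L)) R + egfCoeff (∂ P ∗ freshBlocks L) R
        ∎)
      where
      open ≡-Reasoning
      R! = ℕtoℚ (R !)
      A = egfFrom a 1
      new-block : P ∗ ∂ (freshBlocks L) ≗ A ∗ P ∗ freshBlocks (suc L)
      new-block =
        ≗-trans (∗-congʳ P (≗-trans (∂-newBlocks (egf a) K L) (∗-congˡ (freshBlocks (suc L)) (∂-egf a))))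
                (≗-trans (∗-swapˡ P A (freshBlocks (suc L))) (≗-sym (∗-assoc A P (freshBlocks (suc L)))))

    weight-completion : ∀ p → weight p ≡ [ separated p ]× egfCoeff (blocksEGF p ∗ freshBlocks (length p)) 0
    weight-completion p = begin
      [ (length p ≡ᵇ K) ∧ separated p ]× Π
        ≡⟨ cong (λ c → [ c ]× Π) (∧-comm (length p ≡ᵇ K) (separated p)) ⟩
      [ separated p ∧ (length p ≡ᵇ K) ]× Π
        ≡⟨ if-∧ (separated p) ⟩
      [ separated p ]× [ length p ≡ᵇ K ]× Π
        ≡⟨ cong [ separated p ]×_ (trans ([]×-as-* (length p ≡ᵇ K) Π) (sym (*-identityˡ _))) ⟩
      [ separated p ]× (1ℚ * (Π * [ length p ≡ᵇ K ]× 1ℚ))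
        ≡⟨ cong (λ z → [ separated p ]× (1ℚ * z)) (sym (cong₂ _*_ (blocksEGF-0 p) (newBlocks-egf-0 a K (length p)))) ⟩
      [ separated p ]× egfCoeff (blocksEGF p ∗ freshBlocks (length p)) 0
        ∎
      where
      open ≡-Reasoning
      Π = prodℚ (map (blockWeight a b r) p)

    ∑-insertEach-completion : ∀ {M} → r ℕ.≤ M → ∀ p R →
      ∑[ q ∈ insertEach M p ] ([ separated q ]× egfCoeff (blocksEGF q ∗ freshBlocks (length q)) R)
      ≡ [ separated p ]× egfCoeff (∂ (blocksEGF p) ∗ freshBlocks (length p)) R
    ∑-insertEach-completion {M} r≤M p R = begin
      ∑[ q ∈ insertEach M p ] ([ separated q ]× egfCoeff (blocksEGF q ∗ F (length q)) R)
        ≡⟨ ∑-congᴬ (All.map (λ {q} (|q|≡ , sep≡) → cong₂ (λ s l → [ s ]× egfCoeff (blocksEGF q ∗ F l) R) sep≡ |q|≡)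
                            (insertEach-≥ p r≤M)) ⟩
      ∑[ q ∈ insertEach M p ] ([ separated p ]× egfCoeff (blocksEGF q ∗ F (length p)) R)
        ≡⟨ sym ([]×-∑ (separated p) (insertEach M p) (λ q → egfCoeff (blocksEGF q ∗ F (length p)) R)) ⟩
      [ separated p ]× ∑[ q ∈ insertEach M p ] egfCoeff (blocksEGF q ∗ F (length p)) R
        ≡⟨ cong [ separated p ]×_ (sym (*-∑ (ℕtoℚ (R !)) (insertEach M p) (λ q → (blocksEGF q ∗ F (length p)) R))) ⟩
      [ separated p ]× (ℕtoℚ (R !) * ∑[ q ∈ insertEach M p ] (blocksEGF q ∗ F (length p)) R)
        ≡⟨ cong (λ z → [ separated p ]× (ℕtoℚ (R !) * z)) (∑-insertEach-blocksEGF r≤M p (F (length p)) R) ⟩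
      [ separated p ]× egfCoeff (∂ (blocksEGF p) ∗ F (length p)) R
        ∎
      where
      open ≡-Reasoning
      F = freshBlocks

    extensionWeight-completion : ∀ R p {M} → r ℕ.≤ M →
      extensionWeight p M R ≡ [ separated p ]× egfCoeff (blocksEGF p ∗ freshBlocks (length p)) R
    extensionWeight-completion zero p _ = weight-completion p
    extensionWeight-completion (suc R) p {M} r≤M = begin
      extensionWeight ((M ∷ []) ∷ p) (suc M) R + ∑[ q ∈ insertEach M p ] extensionWeight q (suc M) R
        ≡⟨ cong₂ _+_ (extensionWeight-completion R ((M ∷ []) ∷ p) r≤1+M)
                     (∑-cong (insertEach M p) (λ q → extensionWeight-completion R q r≤1+M)) ⟩
      [ separated ((M ∷ []) ∷ p) ]× egfCoeff (blocksEGF ((M ∷ []) ∷ p) ∗ F (suc (length p))) R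
        + ∑[ q ∈ insertEach M p ] ([ separated q ]× egfCoeff (blocksEGF q ∗ F (length q)) R)
        ≡⟨ cong₂ _+_ new-block (∑-insertEach-completion r≤M p R) ⟩
      [ separated p ]× egfCoeff (egfFrom a 1 ∗ P ∗ F (suc (length p))) R + [ separated p ]× egfCoeff (∂ P ∗ F (length p)) R
        ≡⟨ []×-+ (separated p) _ _ ⟩
      [ separated p ]× (egfCoeff (egfFrom a 1 ∗ P ∗ F (suc (length p))) R + egfCoeff (∂ P ∗ F (length p)) R)
        ≡⟨ cong [ separated p ]×_ (completion-suc P (length p) R) ⟩
      [ separated p ]× egfCoeff (P ∗ F (length p)) (suc R)
        ∎
      where
      open ≡-Reasoning
      F = freshBlocks
      P = blocksEGF p
      r≤1+M = ℕ.m≤n⇒m≤1+n r≤M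
      new-block : [ separated ((M ∷ []) ∷ p) ]× egfCoeff (blocksEGF ((M ∷ []) ∷ p) ∗ F (suc (length p))) R
                ≡ [ separated p ]× egfCoeff (egfFrom a 1 ∗ P ∗ F (suc (length p))) R
      new-block = cong₂ [_]×_ (cong (_∧ separated p) (singleton-separated M))
                              (egfCoeff-cong (∗-congˡ (F (suc (length p))) (∗-congˡ P (blockEGF-new r≤M))) R)

    specials-∷-unseparated : ∀ m B → (specials r B ≤ᵇ 1) ≡ false → (specials r (m ∷ B) ≤ᵇ 1) ≡ false
    specials-∷-unseparated m B B-bad with suc m ≤ᵇ r
    ... | true = suc-bad (specials r B) B-bad
      where
      suc-bad : ∀ s → (s ≤ᵇ 1) ≡ false → (suc s ≤ᵇ 1) ≡ false
      suc-bad (suc (suc s)) _ = refl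
    ... | false = B-bad

    separated-insertEach : ∀ {m} p → separated p ≡ false → All (λ q → separated q ≡ false) (insertEach m p)
    separated-insertEach [] _ = []
    separated-insertEach {m} (B ∷ bs) p-bad with ∧-false-split (specials r B ≤ᵇ 1) (separated bs) p-bad
    ... | inj₁ B-bad = cong (_∧ separated bs) (specials-∷-unseparated m B B-bad)
                       ∷ All.map⁺ (All.universal (λ q → cong (_∧ separated q) B-bad) _)
    ... | inj₂ bs-bad = trans (cong ((specials r (m ∷ B) ≤ᵇ 1) ∧_) bs-bad) (∧-zeroʳ _)
                        ∷ All.map⁺ (All.map (λ q-bad → trans (cong ((specials r B ≤ᵇ 1) ∧_) q-bad) (∧-zeroʳ _))
                                            (separated-insertEach bs bs-bad))

    insertEach-singletons : ∀ {m} j → m ℕ.< r → j ℕ.≤ m → All (λ q → separated q ≡ false) (insertEach m (singletons j))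
    insertEach-singletons zero m<r j≤m = []
    insertEach-singletons {m} (suc j) m<r j<m =
      cong (λ s → (s ≤ᵇ 1) ∧ separated (singletons j)) two-specials
      ∷ All.map⁺ (All.map (λ {q} q-bad → trans (cong (_ ∧_) q-bad) (∧-zeroʳ _))
                          (insertEach-singletons j m<r (ℕ.<⇒≤ j<m)))
      where
      two-specials : specials r (m ∷ j ∷ []) ≡ 2
      two-specials = trans (specials-∷-< (j ∷ []) m<r) (cong suc (specials-∷-< [] (ℕ.<-trans j<m m<r)))

    -- The first j ≤ r elements are all special, so only the partition into singletons separates them.
    ∑-setPartitions-separated : ∀ j → j ℕ.≤ r → ∀ (F : List (List ℕ) → ℚ) →
      ∑[ p ∈ setPartitions j ] ([ separated p ]× F p) ≡ F (singletons j)
    ∑-setPartitions-separated zero _ F = +-identityʳ (F [])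
    ∑-setPartitions-separated (suc j) j<r F = begin
      ∑[ p ∈ setPartitions (suc j) ] ([ separated p ]× F p)
        ≡⟨ ∑-concatMap (λ p → ((j ∷ []) ∷ p) ∷ insertEach j p) (setPartitions j) (λ p → [ separated p ]× F p) ⟩
      ∑[ p ∈ setPartitions j ] ([ separated ((j ∷ []) ∷ p) ]× F ((j ∷ []) ∷ p) + Ins p)
        ≡⟨ ∑-cong (setPartitions j) absorb ⟩
      ∑[ p ∈ setPartitions j ] ([ separated p ]× (F ((j ∷ []) ∷ p) + Ins p))
        ≡⟨ ∑-setPartitions-separated j (ℕ.<⇒≤ j<r) (λ p → F ((j ∷ []) ∷ p) + Ins p) ⟩
      F (singletons (suc j)) + Ins (singletons j)
        ≡⟨ cong (F (singletons (suc j)) +_) (∑-[]×-false separated F (insertEach-singletons j j<r ℕ.≤-refl)) ⟩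
      F (singletons (suc j)) + 0ℚ
        ≡⟨ +-identityʳ _ ⟩
      F (singletons (suc j))
        ∎
      where
      open ≡-Reasoning
      Ins : List (List ℕ) → ℚ
      Ins p = ∑[ q ∈ insertEach j p ] ([ separated q ]× F q)
      absorb : ∀ p → [ separated ((j ∷ []) ∷ p) ]× F ((j ∷ []) ∷ p) + Ins p ≡ [ separated p ]× (F ((j ∷ []) ∷ p) + Ins p)
      absorb p = trans (cong (λ s → [ s ∧ separated p ]× F ((j ∷ []) ∷ p) + Ins p) (singleton-separated j))
                       ([]×-absorb (separated p) _ (Ins p) (λ p-bad → ∑-[]×-false separated F (separated-insertEach p p-bad)))

    blocksEGF-singletons : ∀ j → j ℕ.≤ r → blocksEGF (singletons j) ≗ egfFrom b 1 ^ j
    blocksEGF-singletons zero _ n = refl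
    blocksEGF-singletons (suc j) j<r = ∗-cong special-singleton (blocksEGF-singletons j (ℕ.<⇒≤ j<r))
      where
      special-singleton : blockEGF (j ∷ []) ≗ egfFrom b 1
      special-singleton e = cong (λ s → egfFrom (if s ≡ᵇ 0 then a else b) 1 e) (specials-∷-< [] j<r)

    rBell≡egfCoeff : ∀ n → rBell r (n ℕ.+ r) K a b ≡ egfCoeff (egfFrom b 1 ^ r ∗ freshBlocks r) n
    rBell≡egfCoeff n = begin
      ∑[ p ∈ setPartitions (n ℕ.+ r) ] weight p
        ≡⟨ cong (λ N → ∑[ p ∈ setPartitions N ] weight p) (ℕ.+-comm n r) ⟩
      ∑[ p ∈ setPartitions (r ℕ.+ n) ] weight p
        ≡⟨ ∑-setPartitions-+ n r ⟩
      ∑[ p ∈ setPartitions r ] extensionWeight p r n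
        ≡⟨ ∑-cong (setPartitions r) (λ p → extensionWeight-completion n p ℕ.≤-refl) ⟩
      ∑[ p ∈ setPartitions r ] ([ separated p ]× egfCoeff (blocksEGF p ∗ freshBlocks (length p)) n)
        ≡⟨ ∑-setPartitions-separated r ℕ.≤-refl (λ p → egfCoeff (blocksEGF p ∗ freshBlocks (length p)) n) ⟩
      egfCoeff (blocksEGF (singletons r) ∗ freshBlocks (length (singletons r))) n
        ≡⟨ cong (λ L → egfCoeff (blocksEGF (singletons r) ∗ freshBlocks L) n) (length-singletons r) ⟩
      egfCoeff (blocksEGF (singletons r) ∗ freshBlocks r) n
        ≡⟨ egfCoeff-cong (∗-congˡ (freshBlocks r) (blocksEGF-singletons r ℕ.≤-refl)) n ⟩
      egfCoeff (egfFrom b 1 ^ r ∗ freshBlocks r) n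
        ∎
      where open ≡-Reasoning

  -- The convolution formula

  sumBelow-from : ∀ k N (f : ℕ → ℚ) → k ℕ.≤ N → (∀ j → j ℕ.< k → f j ≡ 0ℚ) →
                  ∑[ j < N ] f j ≡ ∑[ i < N ∸ k ] f (k ℕ.+ i)
  sumBelow-from zero N f _ _ = refl
  sumBelow-from (suc k) (suc N) f (ℕ.s≤s k≤N) f-low =
    trans (cong (_+ ∑[ j < N ] f (suc j)) (f-low 0 ℕ.z<s))
          (trans (+-identityˡ _) (sumBelow-from k N (f ∘ suc) k≤N (λ j j<k → f-low (suc j) (ℕ.s<s j<k))))

  divPow-egf-low : ∀ x k {j} → j ℕ.< k → divPow (egf x) k j ≡ 0ℚ
  divPow-egf-low x k {j} j<k = begin
    divPow (egf x) k j
      ≡⟨ divPow-cong k egf≗t·tail j ⟩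
    divPow (t^[ 1 ] tail (egf x)) k j
      ≡⟨ divPow-t^ 1 (tail (egf x)) k j ⟩
    (t^[ k ℕ.* 1 ] divPow (tail (egf x)) k) j
      ≡⟨ t^-coeff-< (k ℕ.* 1) _ (subst (j ℕ.<_) (sym (ℕ.*-identityʳ k)) j<k) ⟩
    0ℚ
      ∎
    where
    open ≡-Reasoning
    egf≗t·tail : egf x ≗ t^[ 1 ] tail (egf x)
    egf≗t·tail zero = refl
    egf≗t·tail (suc e) = refl

  <∸⇒+≤ : ∀ k n {i} → i ℕ.< suc n ∸ k → k ℕ.+ i ℕ.≤ n
  <∸⇒+≤ zero n i<1+n = ℕ.s≤s⁻¹ i<1+n
  <∸⇒+≤ (suc zero) zero ()
  <∸⇒+≤ (suc (suc k)) zero ()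
  <∸⇒+≤ (suc k) (suc n) i< = ℕ.s≤s (<∸⇒+≤ k n i<)

  sumFromTo-cong : ∀ k n {f g : ℕ → ℚ} → (∀ j → j ℕ.≤ n → f j ≡ g j) → sumFromTo k n f ≡ sumFromTo k n g
  sumFromTo-cong k n f≡g = ∑-congᴬ (All.applyUpTo⁺₁ id (suc n ∸ k) (λ {i} i< → f≡g (k ℕ.+ i) (<∸⇒+≤ k n i<)))

  *-sumFromTo : ∀ c k n (f : ℕ → ℚ) → c * sumFromTo k n f ≡ sumFromTo k n (λ j → c * f j)
  *-sumFromTo c k n f = *-∑ c (upTo (suc n ∸ k)) (λ i → f (k ℕ.+ i))

  egfCoeff-∗-from : ∀ k f g n → k ℕ.≤ n → (∀ j → j ℕ.< k → f j ≡ 0ℚ) →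
    egfCoeff (f ∗ g) n ≡ sumFromTo k n (λ j → ℕtoℚ (n !) * (f j * g (n ∸ j)))
  egfCoeff-∗-from k f g n k≤n f-low = begin
    ℕtoℚ (n !) * (f ∗ g) n
      ≡⟨ cong (ℕtoℚ (n !) *_) (∗-coeff f g n) ⟩
    ℕtoℚ (n !) * ∑[ j < suc n ] (f j * g (n ∸ j))
      ≡⟨ cong (ℕtoℚ (n !) *_) (sumBelow-from k (suc n) _ (ℕ.m≤n⇒m≤1+n k≤n) fg-low) ⟩
    ℕtoℚ (n !) * ∑[ i < suc n ∸ k ] (f (k ℕ.+ i) * g (n ∸ (k ℕ.+ i)))
      ≡⟨ cong (ℕtoℚ (n !) *_) (sym (∑-upTo (suc n ∸ k) (λ i → f (k ℕ.+ i) * g (n ∸ (k ℕ.+ i))))) ⟩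
    ℕtoℚ (n !) * sumFromTo k n (λ j → f j * g (n ∸ j))
      ≡⟨ *-sumFromTo (ℕtoℚ (n !)) k n (λ j → f j * g (n ∸ j)) ⟩
    sumFromTo k n (λ j → ℕtoℚ (n !) * (f j * g (n ∸ j)))
      ∎
    where
    open ≡-Reasoning
    fg-low : ∀ j → j ℕ.< k → f j * g (n ∸ j) ≡ 0ℚ
    fg-low j j<k = trans (cong (_* g (n ∸ j)) (f-low j j<k)) (*-zeroˡ (g (n ∸ j)))

  Bell-*index : ∀ c r m → Bell (r ℕ.+ m) r (λ l → ℕtoℚ l * c l) ≡ ℕtoℚ ((r ℕ.+ m) !) * (invℕ (r !) * (egfFrom c 1 ^ r) m)
  Bell-*index c r m = begin
    Bell (r ℕ.+ m) r (λ l → ℕtoℚ l * c l)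
      ≡⟨ BellEGF.Bell≡egfCoeff (λ l → ℕtoℚ l * c l) (r ℕ.+ m) r ⟩
    R! * divPow (egf (λ l → ℕtoℚ l * c l)) r (r ℕ.+ m)
      ≡⟨ cong (R! *_) (trans (divPow-cong r (egf-*index c) (r ℕ.+ m)) (divPow-t^ 1 β r (r ℕ.+ m))) ⟩
    R! * (t^[ r ℕ.* 1 ] divPow β r) (r ℕ.+ m)
      ≡⟨ cong (λ w → R! * (t^[ w ] divPow β r) (r ℕ.+ m)) (ℕ.*-identityʳ r) ⟩
    R! * (t^[ r ] divPow β r) (r ℕ.+ m)
      ≡⟨ cong (R! *_) (trans (t^-coeff-+ r (divPow β r) m) (divPow≈pow β r m)) ⟩
    R! * (invℕ (r !) * (β ^ r) m)
      ∎
    where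
    open ≡-Reasoning
    β = egfFrom c 1
    R! = ℕtoℚ ((r ℕ.+ m) !)

  choose-factorials : ∀ {N j} → j ℕ.≤ N → (N C j) ℕ.* (j ! ℕ.* (N ∸ j) !) ≡ N !
  choose-factorials {N} {j} j≤N =
    trans (cong (ℕ._* (j ! ℕ.* (N ∸ j) !)) (nCk≡n!/k![n-k]! j≤N)) (m/n*n≡m {{j ℕ.!* (N ∸ j) !≢0}} (k![n∸k]!∣n! j≤N))

  ℕtoℚ-choose : ∀ {N j} → j ℕ.≤ N → ℕtoℚ (N C j) * (ℕtoℚ (j !) * ℕtoℚ ((N ∸ j) !)) ≡ ℕtoℚ (N !)
  ℕtoℚ-choose {N} {j} j≤N = trans (cong (ℕtoℚ (N C j) *_) (sym (ℕtoℚ-* (j !) ((N ∸ j) !))))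
                                   (trans (sym (ℕtoℚ-* (N C j) _)) (cong ℕtoℚ (choose-factorials j≤N)))

  invℕ-choose : ∀ n r → invℕ ((n ℕ.+ r) C r) * invℕ (r !) * ℕtoℚ ((n ℕ.+ r) !) ≡ ℕtoℚ (n !)
  invℕ-choose n r = begin
    invℕ Cr * invℕ (r !) * ℕtoℚ (N !)
      ≡⟨ cong (invℕ Cr * invℕ (r !) *_) (sym N!≡) ⟩
    invℕ Cr * invℕ (r !) * (ℕtoℚ Cr * (ℕtoℚ (r !) * ℕtoℚ n!))
      ≡⟨ regroup (invℕ Cr) (invℕ (r !)) (ℕtoℚ Cr) (ℕtoℚ (r !)) (ℕtoℚ n!) ⟩
    (invℕ Cr * ℕtoℚ Cr) * (invℕ (r !) * ℕtoℚ (r !)) * ℕtoℚ n!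
      ≡⟨ cong₂ (λ u v → u * v * ℕtoℚ n!) (invℕ-inverseˡ Cr {{Cr≢0}}) (invℕ-inverseˡ (r !) {{r ℕ.!≢0}}) ⟩
    1ℚ * 1ℚ * ℕtoℚ n!
      ≡⟨ trans (cong (_* ℕtoℚ n!) (*-identityˡ 1ℚ)) (*-identityˡ (ℕtoℚ n!)) ⟩
    ℕtoℚ n!
      ∎
    where
    open ≡-Reasoning
    N = n ℕ.+ r
    Cr = N C r
    n! = n !
    N!≡ : ℕtoℚ Cr * (ℕtoℚ (r !) * ℕtoℚ n!) ≡ ℕtoℚ (N !)
    N!≡ = subst (λ m → ℕtoℚ Cr * (ℕtoℚ (r !) * ℕtoℚ (m !)) ≡ ℕtoℚ (N !)) (ℕ.m+n∸n≡m n r)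
                (ℕtoℚ-choose (ℕ.m≤n+m r n))
    Cr≢0 : NonZero Cr
    Cr≢0 = ℕ.m*n≢0⇒m≢0 Cr {{subst NonZero (sym (choose-factorials (ℕ.m≤n+m r n))) (N ℕ.!≢0)}}
    regroup : ∀ i j c f m → i * j * (c * (f * m)) ≡ (i * c) * (j * f) * m
    regroup = solve-∀ ℚ-ring

  summand≡convolutionTerm : ∀ a b n k r {j} → j ℕ.≤ n →
    invℕ ((n ℕ.+ r) C r) * (ℕtoℚ ((n ℕ.+ r) C j) * (Bell j k a * Bell (n ℕ.+ r ∸ j) r (λ l → ℕtoℚ l * b l)))
    ≡ ℕtoℚ (n !) * (divPow (egf a) k j * (egfFrom b 1 ^ r) (n ∸ j))
  summand≡convolutionTerm a b n k r {j} j≤n = begin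
    invC * (ℕtoℚ (N C j) * (Bell j k a * Bell (N ∸ j) r (λ l → ℕtoℚ l * b l)))
      ≡⟨ cong (λ z → invC * (ℕtoℚ (N C j) * z)) (cong₂ _*_ (BellEGF.Bell≡egfCoeff a j k) Bell-scaled) ⟩
    invC * (ℕtoℚ (N C j) * ((ℕtoℚ (j !) * E) * (ℕtoℚ ((N ∸ j) !) * (invℕ (r !) * P))))
      ≡⟨ regroup invC (ℕtoℚ (N C j)) (ℕtoℚ (j !)) E (ℕtoℚ ((N ∸ j) !)) (invℕ (r !)) P ⟩
    (invC * invℕ (r !) * (ℕtoℚ (N C j) * (ℕtoℚ (j !) * ℕtoℚ ((N ∸ j) !)))) * (E * P)
      ≡⟨ cong (λ z → (invC * invℕ (r !) * z) * (E * P)) (ℕtoℚ-choose (ℕ.≤-trans j≤n (ℕ.m≤m+n n r))) ⟩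
    (invC * invℕ (r !) * ℕtoℚ (N !)) * (E * P)
      ≡⟨ cong (_* (E * P)) (invℕ-choose n r) ⟩
    ℕtoℚ (n !) * (E * P)
      ∎
    where
    open ≡-Reasoning
    N = n ℕ.+ r
    invC = invℕ (N C r)
    E = divPow (egf a) k j
    P = (egfFrom b 1 ^ r) (n ∸ j)
    N∸j≡ : N ∸ j ≡ r ℕ.+ (n ∸ j)
    N∸j≡ = trans (ℕ.+-∸-comm r j≤n) (ℕ.+-comm (n ∸ j) r)
    Bell-scaled : Bell (N ∸ j) r (λ l → ℕtoℚ l * b l) ≡ ℕtoℚ ((N ∸ j) !) * (invℕ (r !) * P)
    Bell-scaled = trans (cong (λ M → Bell M r (λ l → ℕtoℚ l * b l)) N∸j≡)
                        (trans (Bell-*index b r (n ∸ j)) (cong (λ M → ℕtoℚ (M !) * (invℕ (r !) * P)) (sym N∸j≡)))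
    regroup : ∀ i c f e g h p → i * (c * ((f * e) * (g * (h * p)))) ≡ (i * h * (c * (f * g))) * (e * p)
    regroup = solve-∀ ℚ-ring

  rBell≡egfCoeff-divPow : ∀ a b n k r → rBell r (n ℕ.+ r) (k ℕ.+ r) a b ≡ egfCoeff (divPow (egf a) k ∗ egfFrom b 1 ^ r) n
  rBell≡egfCoeff-divPow a b n k r =
    trans (RBellEGF.rBell≡egfCoeff a b r (k ℕ.+ r) n)
          (egfCoeff-cong (≗-trans (∗-congʳ (egfFrom b 1 ^ r) (cong-app newBlocks≡)) (∗-comm (egfFrom b 1 ^ r) (divPow (egf a) k))) n)
    where
    newBlocks≡ : newBlocks (egf a) (k ℕ.+ r) r ≡ divPow (egf a) k
    newBlocks≡ = trans (cong (λ K → newBlocks (egf a) K r) (ℕ.+-comm k r)) (newBlocks-+ (egf a) r k)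

open GeneratingFunctions

open import Data.Nat using (ℕ; _≤_; _+_; _∸_)
open import Data.Nat.Combinatorics using (_C_)
open import Data.Rational using (ℚ) renaming (_*_ to _*ℚ_)
open import Relation.Binary.PropositionalEquality using (_≡_)
open import Data.Nat using (_!)
open import Relation.Binary.PropositionalEquality using (sym; module ≡-Reasoning)

proposition4 : (a b : ℕ → ℚ) (n k r : ℕ) → k ≤ n →
    rBell r (n + r) (k + r) a b
      ≡ invℕ ((n + r) C r)
        *ℚ sumFromTo k n (λ j → ℕtoℚ ((n + r) C j) *ℚ (Bell j k a *ℚ Bell (n + r ∸ j) r (λ l → ℕtoℚ l *ℚ b l)))
proposition4 a b n k r k≤n = begin
  rBell r (n + r) (k + r) a b
    ≡⟨ rBell≡egfCoeff-divPow a b n k r ⟩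
  egfCoeff (divPow (egf a) k ∗ β ^ r) n
    ≡⟨ egfCoeff-∗-from k (divPow (egf a) k) (β ^ r) n k≤n (λ _ → divPow-egf-low a k) ⟩
  sumFromTo k n (λ j → ℕtoℚ (n !) *ℚ (divPow (egf a) k j *ℚ (β ^ r) (n ∸ j)))
    ≡⟨ sumFromTo-cong k n (λ j j≤n → sym (summand≡convolutionTerm a b n k r j≤n)) ⟩
  sumFromTo k n (λ j → invℕ ((n + r) C r) *ℚ f j)
    ≡⟨ sym (*-sumFromTo (invℕ ((n + r) C r)) k n f) ⟩
  invℕ ((n + r) C r) *ℚ sumFromTo k n f
    ∎
  where
  open ≡-Reasoning
  β = egfFrom b 1
  f : ℕ → ℚ
  f j = ℕtoℚ ((n + r) C j) *ℚ (Bell j k a *ℚ Bell (n + r ∸ j) r (λ l → ℕtoℚ l *ℚ b l))
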